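{- Let $a,b$ be coprime positive integers. Let $\approx$ be the equivalence relation on $\mathbb{Z}^b$ where $D\approx D'$ means $D$ can be converted to $D'$ by a finite sequence of (not necessarily legal) cluster-fire moves $\phi_S$ and borrow moves $\beta_T$ ($S,T\subseteq[b]$ arbitrary), and let $\mathcal{G}=\mathbb{Z}^b/{\approx}$. (a) Addition of integer vectors induces a well-defined group structure on $\mathcal{G}$, and this group is isomorphic to $\mathbb{Z}_a^{b-1}$ (the direct product of $b-1$ copies of the integers modulo $a$). (b) Every equivalence class in $\mathcal{G}$ contains a nonnegative configuration. (c) For any $D,D'\ge0$ in the same equivalence class, $D$ can be transformed into $D'$ by a finite sequence of cluster-fire and borrow moves all of which are legal. (d) For each $k$ with $0\le k<b$, each equivalence class contains exactly one $k$-skeletal chip configuration.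
   Context: Write $[b]=\{1,\dots,b\}$. A chip configuration is a function $D:[b]\to\mathbb{Z}$, identified with $(D(1),\dots,D(b))\in\mathbb{Z}^b$; $D\ge 0$ means all entries are nonnegative. For $S\subseteq[b]$ with $|S|=s$, the cluster-fire move $\phi_S$ subtracts $1+\lfloor (b-s)a/b\rfloor$ from $D(i)$ for each $i\in S$ and adds $\lfloor sa/b\rfloor$ to $D(j)$ for each $j\in[b]\setminus S$ ($\phi_\varnothing$ is the identity). The borrow move $\beta_S$ is the inverse map $\phi_S^{ -1}$. For $D\ge0$, a move $\phi_S$ (resp. $\beta_S$) is legal on $D$ if $\phi_S(D)\ge 0$ (resp. $\beta_S(D)\ge0$); a sequence of moves is legal if each move is legal on the configuration it is applied to. For $0\le k<b$, a $k$-firing move is $\phi_S$ with $0<|S|\le k+1$; $D\ge0$ is $k$-stable if no $k$-firing move is legal on $D$. $D$ is $k$-skeletal if $D$ is $k$-stable and for every nonempty $T\subseteq[b]$ with $\beta_T$ legal on $D$, $\beta_T(D)$ is not $k$-stable. -}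

module Defs where

open import Data.Nat as ℕ using (ℕ; suc; _∸_; NonZero)
open import Data.Nat.DivMod using (_/_)
open import Data.Integer as ℤ using (ℤ; +_; 0ℤ)
open import Data.Fin using (Fin)
open import Data.Fin.Subset using (Subset; ∣_∣)
open import Data.Vec using (lookup)
open import Data.Bool using (Bool; true; false)
open import Data.Product using (Σ; _×_)
open import Data.Sum using (_⊎_)
open import Relation.Nullary using (¬_)
open import Relation.Binary.PropositionalEquality using (_≡_)
open import Relation.Binary.Construct.Closure.ReflexiveTransitive using (Star)

Config : ℕ → Set
Config b = Fin b → ℤ

_⊕_ : ∀ {b} → Config b → Config b → Config b
(D ⊕ E) i = D i ℤ.+ E i

⊖_ : ∀ {b} → Config b → Config b
(⊖ D) i = ℤ.- D i

Nonneg : ∀ {b} → Config b → Set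
Nonneg D = ∀ i → 0ℤ ℤ.≤ D i

_≐_ : ∀ {b} → Config b → Config b → Set
D ≐ E = ∀ i → D i ≡ E i

loss : (a b : ℕ) → {{NonZero b}} → ℕ → ℕ
loss a b s = suc (((b ∸ s) ℕ.* a) / b)

gain : (a b : ℕ) → {{NonZero b}} → ℕ → ℕ
gain a b s = (s ℕ.* a) / b

fire : (a b : ℕ) → {{_ : NonZero b}} → Subset b → Config b → Config b
fire a b S D i with lookup S i
... | true  = D i ℤ.- (+ loss a b ∣ S ∣)
... | false = D i ℤ.+ (+ gain a b ∣ S ∣)

-- borrow move β_S = φ_S⁻¹ (written out explicitly)
borrow : (a b : ℕ) → {{_ : NonZero b}} → Subset b → Config b → Config b
borrow a b S D i with lookup S i
... | true  = D i ℤ.+ (+ loss a b ∣ S ∣)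
... | false = D i ℤ.- (+ gain a b ∣ S ∣)

Move : (a b : ℕ) → {{_ : NonZero b}} → Config b → Config b → Set
Move a b D D' = Σ (Subset b) λ S → (D' ≐ fire a b S D) ⊎ (D' ≐ borrow a b S D)

Equiv : (a b : ℕ) → {{_ : NonZero b}} → Config b → Config b → Set
Equiv a b = Star (Move a b)

LegalMove : (a b : ℕ) → {{_ : NonZero b}} → Config b → Config b → Set
LegalMove a b D D' = Nonneg D × Nonneg D' × Move a b D D'

LegalEquiv : (a b : ℕ) → {{_ : NonZero b}} → Config b → Config b → Set
LegalEquiv a b = Star (LegalMove a b)

Stable : (a b : ℕ) → {{_ : NonZero b}} → ℕ → Config b → Set
Stable a b k D = Nonneg D ×
  (∀ (S : Subset b) → 0 ℕ.< ∣ S ∣ → ∣ S ∣ ℕ.≤ suc k → ¬ Nonneg (fire a b S D))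

Skeletal : (a b : ℕ) → {{_ : NonZero b}} → ℕ → Config b → Set
Skeletal a b k D = Stable a b k D ×
  (∀ (T : Subset b) → 0 ℕ.< ∣ T ∣ → Nonneg (borrow a b T D) → ¬ Stable a b k (borrow a b T D))

-- Write D ∼ E when E - D is constant modulo a. Every move preserves ∼: for s = |S| < b, firing S
-- changes the vertices of S by -loss s = gain s - a and the others by gain s, since coprimality gives
-- loss s + gain s = a. Conversely, raising every vertex by gain |T| and then borrowing T adds a to the
-- vertices of T only, so nonnegative ∼-related configurations are joined by legal moves. Hence ≈ is ∼,
-- and (a)-(c) follow.
--
-- For (d), a k-stable configuration y has all entries below a, and the bounded members of its class
-- are its a rotations (y + m) mod a. Firing a proper S is legal iff all its vertices wrap around under
-- rotation by gain |S|, and the number of wrapping vertices also controls the sum: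
-- sum (rotate j y) + a · wraps y j = sum y + b j. The k-skeletal member of a class is its k-stable
-- rotation of largest sum: borrowing raises the sum, while from a skeletal y a stable rotation of
-- larger sum could be reached by one legal borrow (or, if b ≤ k + 1, is not stable at all).
-- Coprimality makes the sums of distinct rotations distinct.

{-# OPTIONS --safe #-}
module Submission where

open import Defs
open import Data.Nat as ℕ using (ℕ; NonZero)
open import Data.Nat.Coprimality using (Coprime)
open import Data.Fin using (Fin)
open import Data.Fin.Subset using (Subset; ∣_∣; ⊤; ⁅_⁆)
open import Data.Vec using (lookup; tabulate)
open import Data.Bool using (Bool; true; false; not)
open import Data.Product using (Σ; ∃; _×_; _,_; proj₁; proj₂)
open import Data.Sum using (inj₁; inj₂)
open import Data.Empty using (⊥-elim)
open import Data.Unit using (tt)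
open import Function using (_∘_)
open import Relation.Nullary using (¬_; yes; no)
open import Relation.Unary using (Decidable)
open import Relation.Binary.PropositionalEquality
open import Relation.Binary.Construct.Closure.ReflexiveTransitive using (ε; _◅_; _◅◅_; reverse)

module _ where
  open import Data.Nat using (zero; suc; _+_; _*_; _∸_; _≤_; _<_; z≤n; s≤s; _≤?_)
  open import Data.Nat.Properties
  open import Data.Nat.DivMod
  open import Data.Fin using (zero; suc)
  open import Data.Vec using ([]; _∷_)
  open import Data.Sum using (_⊎_)
  open import Data.Nat.Divisibility using (_∣_; divides)
  open import Relation.Nullary using (Dec; does)
  open import Relation.Nullary.Decidable using (dec-true; dec-false)
  open import Relation.Binary using (Total; Transitive; Reflexive)
  open import Algebra.Properties.Semiring.Sum +-*-semiring public
    using (sum; sum-cong-≗; ∑-distrib-+; *-distribˡ-sum; *-distribʳ-sum)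

  sum-const : ∀ {n} c → sum {n} (λ _ → c) ≡ n * c
  sum-const {zero}  c = refl
  sum-const {suc n} c = cong (c +_) (sum-const {n} c)

  sum-mono-≤ : ∀ {n} {f g : Fin n → ℕ} → (∀ i → f i ≤ g i) → sum f ≤ sum g
  sum-mono-≤ {zero}  f≤g = z≤n
  sum-mono-≤ {suc n} f≤g = +-mono-≤ (f≤g zero) (sum-mono-≤ (f≤g ∘ suc))

  term≤sum : ∀ {n} (f : Fin n → ℕ) i → f i ≤ sum f
  term≤sum f zero    = m≤m+n _ _
  term≤sum f (suc i) = ≤-trans (term≤sum (λ j → f (suc j)) i) (m≤n+m _ (f zero))

  indicator : Bool → ℕ
  indicator true  = 1
  indicator false = 0

  count : ∀ {n} → (Fin n → Bool) → ℕ
  count p = sum (λ i → indicator (p i))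

  indicator-dec-yes : ∀ {P : Set} (P? : Dec P) → P → indicator (does P?) ≡ 1
  indicator-dec-yes P? p = cong indicator (dec-true P? p)

  indicator-dec-no : ∀ {P : Set} (P? : Dec P) → ¬ P → indicator (does P?) ≡ 0
  indicator-dec-no P? ¬p = cong indicator (dec-false P? ¬p)

  ∣p∣≡count : ∀ {n} (S : Subset n) → ∣ S ∣ ≡ count (lookup S)
  ∣p∣≡count []          = refl
  ∣p∣≡count (true ∷ S)  = cong suc (∣p∣≡count S)
  ∣p∣≡count (false ∷ S) = ∣p∣≡count S

  count>0 : ∀ {n} (p : Fin n → Bool) {i} → p i ≡ true → 0 < count p
  count>0 p {i} pi≡true = ≤-trans (≤-reflexive (cong indicator (sym pi≡true))) (term≤sum _ i)

  ∣p∣>0 : ∀ {n} (S : Subset n) {i} → lookup S i ≡ true → 0 < ∣ S ∣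
  ∣p∣>0 S i∈S = subst (0 <_) (sym (∣p∣≡count S)) (count>0 (lookup S) i∈S)

  count+count-not : ∀ {n} (p : Fin n → Bool) → count p + count (not ∘ p) ≡ n
  count+count-not {zero}  p = refl
  count+count-not {suc n} p with p zero
  ... | true  = cong suc (count+count-not (λ i → p (suc i)))
  ... | false = trans (+-suc _ _) (cong suc (count+count-not (λ i → p (suc i))))

  count≤n : ∀ {n} (p : Fin n → Bool) → count p ≤ n
  count≤n p = subst (count p ≤_) (count+count-not p) (m≤m+n _ _)

  count<n : ∀ {n} {P : Fin n → Set} (P? : Decidable P) {i} → ¬ P i → count (λ j → does (P? j)) < n
  count<n P? {zero} ¬p with P? zero
  ... | yes p = ⊥-elim (¬p p)
  ... | no _  = s≤s (count≤n (λ j → does (P? (suc j))))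
  count<n P? {suc i} ¬p with P? zero
  ... | yes _ = s≤s (count<n (λ j → P? (suc j)) ¬p)
  ... | no _  = m<n⇒m<1+n (count<n (λ j → P? (suc j)) ¬p)

  count<n⇒∃¬ : ∀ {n} {P : Fin n → Set} (P? : Decidable P) → count (λ j → does (P? j)) < n → ∃ λ i → ¬ P i
  count<n⇒∃¬ {suc n} P? lt with P? zero
  ... | no ¬p = zero , ¬p
  ... | yes _ with count<n⇒∃¬ (λ j → P? (suc j)) (≤-pred lt)
  ...   | i , ¬p = suc i , ¬p

  choose : ∀ {n} {P : Fin n → Set} (P? : Decidable P) s → s ≤ count (λ i → does (P? i)) →
           ∃ λ (S : Subset n) → ∣ S ∣ ≡ s × (∀ {i} → lookup S i ≡ true → P i)
  choose {zero}  P? zero    _ = [] , refl , λ { {()} }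
  choose {suc n} P? s s≤count with P? zero
  ... | yes p with s
  ...   | zero  = let S , ∣S∣≡0 , ⊆P = choose (λ i → P? (suc i)) 0 z≤n in
                  false ∷ S , ∣S∣≡0 , λ { {suc i} → ⊆P }
  ...   | suc s′ = let S , ∣S∣≡s′ , ⊆P = choose (λ i → P? (suc i)) s′ (≤-pred s≤count) in
                   true ∷ S , cong suc ∣S∣≡s′ , λ { {zero} _ → p ; {suc i} → ⊆P }
  choose {suc n} P? s s≤count | no _ =
    let S , ∣S∣≡s , ⊆P = choose (λ i → P? (suc i)) s s≤count in
    false ∷ S , ∣S∣≡s , λ { {suc i} → ⊆P }

  below-suc : ∀ {Q : ℕ → Set} {n} → (∀ {j} → j < n → Q j) → Q n → ∀ {j} → j < suc n → Q j
  below-suc below at {j} j<1+n with m<1+n⇒m<n∨m≡n j<1+n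
  ... | inj₁ j<n  = below j<n
  ... | inj₂ refl = at

  module _ {P : ℕ → Set} (P? : Decidable P) {_≼_ : ℕ → ℕ → Set}
           (≼-refl : Reflexive _≼_) (≼-trans : Transitive _≼_) (≼-total : Total _≼_) where

    Least : ℕ → ℕ → Set
    Least n j = j < n × P j × (∀ {i} → i < n → P i → j ≼ i)

    private
      search : ∀ n → (∀ {j} → j < n → ¬ P j) ⊎ ∃ (Least n)
      search zero = inj₁ λ ()
      search (suc n) with search n | P? n
      ... | inj₁ none | no ¬pn = inj₁ (below-suc none ¬pn)
      ... | inj₁ none | yes pn =
        inj₂ (n , ≤-refl , pn , below-suc {λ i → P i → n ≼ i} (λ i<n pi → ⊥-elim (none i<n pi)) (λ _ → ≼-refl))
      ... | inj₂ (j , j<n , pj , least) | no ¬pn =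
        inj₂ (j , m<n⇒m<1+n j<n , pj , below-suc least (λ pn → ⊥-elim (¬pn pn)))
      ... | inj₂ (j , j<n , pj , least) | yes pn with ≼-total j n
      ...   | inj₁ j≼n = inj₂ (j , m<n⇒m<1+n j<n , pj , below-suc least (λ _ → j≼n))
      ...   | inj₂ n≼j = inj₂ (n , ≤-refl , pn ,
                             below-suc {λ i → P i → n ≼ i} (λ i<n pi → ≼-trans n≼j (least i<n pi)) (λ _ → ≼-refl))

    least : ∀ n → (∃ λ j → j < n × P j) → ∃ (Least n)
    least n (j , j<n , pj) with search n
    ... | inj₁ none = ⊥-elim (none j<n pj)
    ... | inj₂ r    = r

  module _ {P : ℕ → Set} (P? : Decidable P) (f : ℕ → ℕ) where

    argmin : ∀ n → (∃ λ j → j < n × P j) → ∃ λ j → j < n × P j × (∀ {i} → i < n → P i → f j ≤ f i)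
    argmin = least P? ≤-refl ≤-trans (λ i j → ≤-total (f i) (f j))

    argmax : ∀ n → (∃ λ j → j < n × P j) → ∃ λ j → j < n × P j × (∀ {i} → i < n → P i → f i ≤ f j)
    argmax = least P? ≤-refl (λ p q → ≤-trans q p) (λ i j → ≤-total (f j) (f i))

  %-wrap : ∀ {a} .{{_ : NonZero a}} {x} → a ≤ x → x < a + a → x % a ≡ x ∸ a
  %-wrap {a} {x} a≤x x<2a = trans (sym (m≤n⇒[n∸m]%m≡n%m a≤x))
    (m<n⇒m%n≡m (subst (x ∸ a <_) (m+n∸n≡m a a) (∸-monoˡ-< x<2a a≤x)))

  [m%n+k]%n≡[m+k]%n : ∀ m k n .{{_ : NonZero n}} → (m % n + k) % n ≡ (m + k) % n
  [m%n+k]%n≡[m+k]%n m k n = begin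
    (m % n + k) % n           ≡⟨ %-distribˡ-+ (m % n) k n ⟩
    (m % n % n + k % n) % n   ≡⟨ cong (λ z → (z + k % n) % n) (m%n%n≡m%n m n) ⟩
    (m % n + k % n) % n       ≡⟨ sym (%-distribˡ-+ m k n) ⟩
    (m + k) % n               ∎
    where open ≡-Reasoning

  only-multiple-below-double : ∀ {m n} → m ∣ n → 0 < n → n < m + m → n ≡ m
  only-multiple-below-double (divides zero refl)          ()  _
  only-multiple-below-double (divides (suc zero) refl)    _   _   = +-identityʳ _
  only-multiple-below-double {m} (divides (suc (suc k)) refl) _ n<2m =
    ⊥-elim (<⇒≱ n<2m (+-monoʳ-≤ m (m≤m+n m (k * m))))

  /-between : ∀ {x q d} .{{_ : NonZero d}} → q * d ≤ x → x < suc q * d → x / d ≡ q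
  /-between {x} {q} {d} lo hi =
    ≤-antisym (≤-pred (m<n*o⇒m/o<n hi)) (subst (_≤ x / d) (m*n/n≡m q d) (/-monoˡ-≤ d lo))

  module Rotation (a : ℕ) {{_ : NonZero a}} {n : ℕ} where

    Bounded : (Fin n → ℕ) → Set
    Bounded y = ∀ i → y i < a

    rotate : ℕ → (Fin n → ℕ) → Fin n → ℕ
    rotate m y i = (y i + m) % a

    wraps : (Fin n → ℕ) → ℕ → ℕ
    wraps y j = count (λ i → does (a ≤? y i + j))

    rotate-bounded : ∀ m y → Bounded (rotate m y)
    rotate-bounded m y i = m%n<n (y i + m) a

    rotate-rotate : ∀ m j y → rotate j (rotate m y) ≗ rotate (m + j) y
    rotate-rotate m j y i = trans ([m%n+k]%n≡[m+k]%n (y i + m) j a) (cong (_% a) (+-assoc (y i) m j))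

    rotate-% : ∀ m y → rotate (m % a) y ≗ rotate m y
    rotate-% m y i = begin
      (y i + m % a) % a ≡⟨ cong (_% a) (+-comm (y i) (m % a)) ⟩
      (m % a + y i) % a ≡⟨ [m%n+k]%n≡[m+k]%n m (y i) a ⟩
      (m + y i) % a     ≡⟨ cong (_% a) (+-comm m (y i)) ⟩
      (y i + m) % a     ∎
      where open ≡-Reasoning

    rotate-zero : ∀ {y} → Bounded y → rotate 0 y ≗ y
    rotate-zero {y} y<a i = trans (cong (_% a) (+-identityʳ (y i))) (m<n⇒m%n≡m (y<a i))

    rotate-inverse : ∀ {y} L → Bounded y → L ≤ a → rotate (a ∸ L) (rotate L y) ≗ y
    rotate-inverse {y} L y<a L≤a i = begin
      rotate (a ∸ L) (rotate L y) i ≡⟨ rotate-rotate L (a ∸ L) y i ⟩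
      (y i + (L + (a ∸ L))) % a     ≡⟨ cong (λ z → (y i + z) % a) (m+[n∸m]≡n L≤a) ⟩
      (y i + a) % a                 ≡⟨ [m+n]%n≡m%n (y i) a ⟩
      y i % a                       ≡⟨ m<n⇒m%n≡m (y<a i) ⟩
      y i                           ∎
      where open ≡-Reasoning

    sum-rotate-suc : ∀ j y → sum (rotate (suc j) y) ≤ sum (rotate j y) + n
    sum-rotate-suc j y = begin
      sum (rotate (suc j) y)             ≡⟨ sum-cong-≗ (λ i → trans (cong (λ m → (y i + m) % a) (+-comm 1 j))
                                                                     (sym (rotate-rotate j 1 y i))) ⟩
      sum (rotate 1 (rotate j y))        ≤⟨ sum-mono-≤ (λ i → m%n≤m (rotate j y i + 1) a) ⟩
      sum (λ i → rotate j y i + 1)       ≡⟨ ∑-distrib-+ (rotate j y) (λ _ → 1) ⟩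
      sum (rotate j y) + sum {n} (λ _ → 1) ≡⟨ cong (sum (rotate j y) +_) (trans (sum-const {n} 1) (*-identityʳ n)) ⟩
      sum (rotate j y) + n               ∎
      where open ≤-Reasoning

    wraps-cong : ∀ {y z} j → y ≗ z → wraps y j ≡ wraps z j
    wraps-cong j y≗z = sum-cong-≗ (λ i → cong (λ x → indicator (does (a ≤? x + j))) (y≗z i))

    wraps-mono : ∀ y {j j'} → j ≤ j' → wraps y j ≤ wraps y j'
    wraps-mono y {j} {j'} j≤j' = sum-mono-≤ pointwise
      where
      pointwise : ∀ i → indicator (does (a ≤? y i + j)) ≤ indicator (does (a ≤? y i + j'))
      pointwise i with a ≤? y i + j
      ... | yes a≤ = ≤-reflexive (trans (indicator-dec-yes (a ≤? y i + j) a≤)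
                       (sym (indicator-dec-yes (a ≤? y i + j') (≤-trans a≤ (+-monoʳ-≤ (y i) j≤j')))))
      ... | no a≰  = ≤-trans (≤-reflexive (indicator-dec-no (a ≤? y i + j) a≰)) z≤n

    -- Each coordinate loses exactly a when it wraps around.
    sum-rotate : ∀ {y} j → Bounded y → j ≤ a → sum (rotate j y) + a * wraps y j ≡ sum y + n * j
    sum-rotate {y} j y<a j≤a = begin
      sum (rotate j y) + a * wraps y j
        ≡⟨ cong (sum (rotate j y) +_) (*-distribˡ-sum a (λ i → indicator (does (a ≤? y i + j)))) ⟩
      sum (rotate j y) + sum (λ i → a * indicator (does (a ≤? y i + j)))
        ≡⟨ sym (∑-distrib-+ (rotate j y) _) ⟩
      sum (λ i → rotate j y i + a * indicator (does (a ≤? y i + j)))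
        ≡⟨ sum-cong-≗ (λ i → pointwise (y<a i)) ⟩
      sum (λ i → y i + j)
        ≡⟨ ∑-distrib-+ y (λ _ → j) ⟩
      sum y + sum {n} (λ _ → j)
        ≡⟨ cong (sum y +_) (sum-const {n} j) ⟩
      sum y + n * j
        ∎
      where
      open ≡-Reasoning
      pointwise : ∀ {x} → x < a → (x + j) % a + a * indicator (does (a ≤? x + j)) ≡ x + j
      pointwise {x} x<a with a ≤? x + j
      ... | yes a≤ = begin
        (x + j) % a + a * indicator (does (a ≤? x + j))
          ≡⟨ cong₂ (λ u v → u + a * v) (%-wrap a≤ (+-mono-<-≤ x<a j≤a)) (indicator-dec-yes (a ≤? x + j) a≤) ⟩
        (x + j ∸ a) + a * 1 ≡⟨ cong ((x + j ∸ a) +_) (*-identityʳ a) ⟩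
        (x + j ∸ a) + a     ≡⟨ m∸n+n≡m a≤ ⟩
        x + j               ∎
      ... | no a≰ = begin
        (x + j) % a + a * indicator (does (a ≤? x + j))
          ≡⟨ cong₂ (λ u v → u + a * v) (m<n⇒m%n≡m (≰⇒> a≰)) (indicator-dec-no (a ≤? x + j) a≰) ⟩
        (x + j) + a * 0 ≡⟨ cong ((x + j) +_) (*-zeroʳ a) ⟩
        (x + j) + 0         ≡⟨ +-identityʳ (x + j) ⟩
        x + j               ∎

    wraps-+ : ∀ {y} j j' → Bounded y → j + j' ≤ a → wraps y (j + j') ≡ wraps y j + wraps (rotate j y) j'
    wraps-+ {y} j j' y<a j+j'≤a =
      trans (sum-cong-≗ (λ i → pointwise (y<a i)))
            (∑-distrib-+ (λ i → indicator (does (a ≤? y i + j))) (λ i → indicator (does (a ≤? rotate j y i + j'))))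
      where
      pointwise : ∀ {x} → x < a → indicator (does (a ≤? x + (j + j')))
                    ≡ indicator (does (a ≤? x + j)) + indicator (does (a ≤? (x + j) % a + j'))
      pointwise {x} x<a with a ≤? x + j
      ... | yes a≤ = trans (indicator-dec-yes (a ≤? x + (j + j')) (≤-trans a≤ (+-monoʳ-≤ x (m≤m+n j j'))))
                           (sym (cong₂ _+_ (indicator-dec-yes (a ≤? x + j) a≤)
                                           (indicator-dec-no (a ≤? (x + j) % a + j') (<⇒≱ no-second-wrap))))
        where
        no-second-wrap : (x + j) % a + j' < a
        no-second-wrap = begin-strict
          (x + j) % a + j'   ≡⟨ cong (_+ j') (%-wrap a≤ (+-mono-<-≤ x<a (≤-trans (m≤m+n j j') j+j'≤a))) ⟩
          x + j ∸ a + j'     ≡⟨ sym (+-∸-comm j' a≤) ⟩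
          x + j + j' ∸ a     ≡⟨ cong (_∸ a) (+-assoc x j j') ⟩
          x + (j + j') ∸ a   ≤⟨ ∸-monoˡ-≤ a (+-monoʳ-≤ x j+j'≤a) ⟩
          x + a ∸ a          ≡⟨ m+n∸n≡m x a ⟩
          x                  <⟨ x<a ⟩
          a                  ∎
          where open ≤-Reasoning
      ... | no a≰ = begin
        indicator (does (a ≤? x + (j + j')))
          ≡⟨ cong (λ z → indicator (does (a ≤? z)))
                  (trans (sym (+-assoc x j j')) (cong (_+ j') (sym (m<n⇒m%n≡m (≰⇒> a≰))))) ⟩
        indicator (does (a ≤? (x + j) % a + j'))
          ≡⟨ cong (_+ indicator (does (a ≤? (x + j) % a + j'))) (sym (indicator-dec-no (a ≤? x + j) a≰)) ⟩
        indicator (does (a ≤? x + j)) + indicator (does (a ≤? (x + j) % a + j')) ∎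
        where open ≡-Reasoning

module GainLoss (a b : ℕ) {{_ : NonZero a}} {{_ : NonZero b}} where
  open import Data.Nat using (zero; suc; _+_; _*_; _∸_; _≤_; _<_; >-nonZero; >-nonZero⁻¹)
  open import Data.Nat.Properties
  open import Data.Nat.DivMod
  open import Data.Nat.Divisibility using (_∣_; divides; ∣⇒≤; ∣m+n∣m⇒∣n; n∣m*n; m%n≡0⇒n∣m)
  open import Data.Nat.Coprimality as Coprimality using (Coprime; coprime-divisor)
  open import Data.Nat.Tactic.RingSolver using (solve-∀)
  open import Data.Empty using (⊥-elim)

  s*a<[1+gain]*b : ∀ s → s * a < suc (gain a b s) * b
  s*a<[1+gain]*b s = begin-strict
    s * a                              ≡⟨ m≡m%n+[m/n]*n (s * a) b ⟩
    (s * a) % b + gain a b s * b       <⟨ +-monoˡ-< (gain a b s * b) (m%n<n (s * a) b) ⟩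
    b + gain a b s * b                 ∎
    where open ≤-Reasoning

  loss-full : loss a b b ≡ 1
  loss-full = cong suc (trans (cong (λ x → (x * a) / b) (n∸n≡0 b)) (0/n≡0 b))

  gain<a : ∀ {s} → s < b → gain a b s < a
  gain<a {s} s<b = m<n*o⇒m/o<n (subst (s * a <_) (*-comm b a) (*-monoˡ-< a s<b))

  loss-1≤a : loss a b 1 ≤ a
  loss-1≤a = m<n*o⇒m/o<n (subst ((b ∸ 1) * a <_) (*-comm b a)
               (*-monoˡ-< a (∸-monoʳ-< {o = 0} ≤-refl (>-nonZero⁻¹ b))))

  -- The bounds pin down ⌊(b - t)a/b⌋ = m - 1.
  loss-between : ∀ {t m} → a * (b ∸ t) < b * m → b * m ≤ a * (b ∸ t) + b → loss a b t ≡ m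
  loss-between {t} {zero}  lo _  = ⊥-elim (n≮0 (subst (a * (b ∸ t) <_) (*-zeroʳ b) lo))
  loss-between {t} {suc m} lo hi = cong suc (/-between
    (subst₂ _≤_ (*-comm b m) (*-comm a (b ∸ t))
      (+-cancelʳ-≤ b (b * m) (a * (b ∸ t)) (subst (_≤ a * (b ∸ t) + b) (trans (*-suc b m) (+-comm b (b * m))) hi)))
    (subst₂ _<_ (*-comm a (b ∸ t)) (*-comm b (suc m)) lo))

  module _ (cop : Coprime a b) where

    b∤s*a : ∀ {s} → 0 < s → s < b → ¬ b ∣ s * a
    b∤s*a {s} 0<s s<b b∣sa = <⇒≱ s<b
      (∣⇒≤ {{>-nonZero 0<s}} (coprime-divisor (Coprimality.sym cop) (subst (b ∣_) (*-comm s a) b∣sa)))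

    gain*b<s*a : ∀ {s} → 0 < s → s < b → gain a b s * b < s * a
    gain*b<s*a {s} 0<s s<b = ≤∧≢⇒< (m/n*n≤m (s * a) b) λ eq → b∤s*a 0<s s<b (divides (gain a b s) (sym eq))

    -- The remainders of (b - s)a and sa modulo b are nonzero and add up to b.
    loss+gain≡a : ∀ {s} → 0 < s → s < b → loss a b s + gain a b s ≡ a
    loss+gain≡a {s} 0<s s<b = *-cancelʳ-≡ _ _ b (begin
      (suc q + g) * b         ≡⟨ solve q g b ⟩
      b + (q + g) * b         ≡⟨ cong (_+ (q + g) * b) (sym r+r′≡b) ⟩
      (r + r′) + (q + g) * b  ≡⟨ sum-of-parts ⟩
      a * b                   ∎)
      where
      open ≡-Reasoning
      t q g r r′ : ℕ
      t = b ∸ s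
      q = (t * a) / b
      g = gain a b s
      r = (t * a) % b
      r′ = (s * a) % b
      solve : ∀ q g b → (suc q + g) * b ≡ b + (q + g) * b
      solve = solve-∀
      rearrange : ∀ r r′ q g b → (r + r′) + (q + g) * b ≡ (r + q * b) + (r′ + g * b)
      rearrange = solve-∀
      sum-of-parts : (r + r′) + (q + g) * b ≡ a * b
      sum-of-parts = begin
        (r + r′) + (q + g) * b        ≡⟨ rearrange r r′ q g b ⟩
        (r + q * b) + (r′ + g * b)    ≡⟨ sym (cong₂ _+_ (m≡m%n+[m/n]*n (t * a) b) (m≡m%n+[m/n]*n (s * a) b)) ⟩
        t * a + s * a                 ≡⟨ sym (*-distribʳ-+ a t s) ⟩
        (t + s) * a                   ≡⟨ cong (_* a) (m∸n+n≡m (<⇒≤ s<b)) ⟩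
        b * a                         ≡⟨ *-comm b a ⟩
        a * b                         ∎
      r+r′≡b : r + r′ ≡ b
      r+r′≡b = only-multiple-below-double
        (∣m+n∣m⇒∣n (subst (b ∣_) (trans (sym sum-of-parts) (+-comm (r + r′) _)) (n∣m*n a)) (n∣m*n (q + g)))
        (<-≤-trans (n≢0⇒n>0 λ r′≡0 → b∤s*a 0<s s<b (m%n≡0⇒n∣m (s * a) b r′≡0)) (m≤n+m r′ r))
        (+-mono-< (m%n<n (t * a) b) (m%n<n (s * a) b))

    -- Borrowing t vertices adds t · loss t chips and removes (b - t) · gain t.
    gain-outweighed : ∀ {t} → 0 < t → t ≤ b → (b ∸ t) * gain a b t < t * loss a b t
    gain-outweighed {t} 0<t t≤b with m≤n⇒m<n∨m≡n t≤b
    ... | inj₂ refl = subst₂ _<_ (cong (_* gain a b b) (sym (n∸n≡0 b))) (sym (trans (cong (b *_) loss-full) (*-identityʳ b)))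
                             (>-nonZero⁻¹ b)
    ... | inj₁ t<b = +-cancelʳ-< (t * g) ((b ∸ t) * g) (t * l) (begin-strict
      (b ∸ t) * g + t * g   ≡⟨ *-distribʳ-+ g (b ∸ t) t ⟨
      (b ∸ t + t) * g       ≡⟨ cong (_* g) (m∸n+n≡m t≤b) ⟩
      b * g                 ≡⟨ *-comm b g ⟩
      g * b                 <⟨ gain*b<s*a 0<t t<b ⟩
      t * a                 ≡⟨ cong (t *_) (loss+gain≡a 0<t t<b) ⟨
      t * (l + g)           ≡⟨ *-distribˡ-+ t l g ⟩
      t * l + t * g         ∎)
      where
      open ≤-Reasoning
      l g : ℕ
      l = loss a b t
      g = gain a b t

≐-sym : ∀ {b} {D E : Config b} → D ≐ E → E ≐ D
≐-sym D≐E i = sym (D≐E i)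

≐-trans : ∀ {b} {D E F : Config b} → D ≐ E → E ≐ F → D ≐ F
≐-trans D≐E E≐F i = trans (D≐E i) (E≐F i)

module Moves (a b : ℕ) {{_ : NonZero a}} {{_ : NonZero b}} where
  open import Data.Nat using (zero; suc; z≤n)
  open import Data.Integer using (+_; 0ℤ; _+_; _-_; _≤_; +≤+)
  open import Data.Integer.Properties using (+-mono-≤; +-identityʳ)
  open import Data.Integer.Tactic.RingSolver using (solve-∀)
  open import Data.Fin.Subset.Properties using (∣⊤∣≡n)
  open import Data.Vec.Properties using (lookup-replicate)
  open GainLoss a b

  fire-inside : ∀ S (D : Config b) {i} → lookup S i ≡ true → fire a b S D i ≡ D i - + loss a b ∣ S ∣
  fire-inside S D {i} i∈S with lookup S i
  ... | true = refl

  fire-outside : ∀ S (D : Config b) {i} → lookup S i ≡ false → fire a b S D i ≡ D i + + gain a b ∣ S ∣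
  fire-outside S D {i} i∉S with lookup S i
  ... | false = refl

  borrow-inside : ∀ S (D : Config b) {i} → lookup S i ≡ true → borrow a b S D i ≡ D i + + loss a b ∣ S ∣
  borrow-inside S D {i} i∈S with lookup S i
  ... | true = refl

  borrow-outside : ∀ S (D : Config b) {i} → lookup S i ≡ false → borrow a b S D i ≡ D i - + gain a b ∣ S ∣
  borrow-outside S D {i} i∉S with lookup S i
  ... | false = refl

  fire-cong : ∀ S {D E : Config b} → D ≐ E → fire a b S D ≐ fire a b S E
  fire-cong S D≐E i with lookup S i
  ... | true  = cong (_- + loss a b ∣ S ∣) (D≐E i)
  ... | false = cong (_+ + gain a b ∣ S ∣) (D≐E i)

  borrow-cong : ∀ S {D E : Config b} → D ≐ E → borrow a b S D ≐ borrow a b S E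
  borrow-cong S D≐E i with lookup S i
  ... | true  = cong (_+ + loss a b ∣ S ∣) (D≐E i)
  ... | false = cong (_- + gain a b ∣ S ∣) (D≐E i)

  private
    [x-y]+y≡x : ∀ x y → (x - y) + y ≡ x
    [x-y]+y≡x = solve-∀
    [x+y]-y≡x : ∀ x y → (x + y) - y ≡ x
    [x+y]-y≡x = solve-∀

  borrow-fire : ∀ S (D : Config b) → borrow a b S (fire a b S D) ≐ D
  borrow-fire S D i with lookup S i in i∈?S
  ... | true  = trans (cong (_+ + loss a b ∣ S ∣) (fire-inside S D i∈?S)) ([x-y]+y≡x (D i) _)
  ... | false = trans (cong (_- + gain a b ∣ S ∣) (fire-outside S D i∈?S)) ([x+y]-y≡x (D i) _)

  fire-borrow : ∀ S (D : Config b) → fire a b S (borrow a b S D) ≐ D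
  fire-borrow S D i with lookup S i in i∈?S
  ... | true  = trans (cong (_- + loss a b ∣ S ∣) (borrow-inside S D i∈?S)) ([x+y]-y≡x (D i) _)
  ... | false = trans (cong (_+ + gain a b ∣ S ∣) (borrow-outside S D i∈?S)) ([x-y]+y≡x (D i) _)

  Move-sym : ∀ {D E : Config b} → Move a b D E → Move a b E D
  Move-sym {D} (S , inj₁ E≐φD) = S , inj₂ (≐-sym (≐-trans (borrow-cong S E≐φD) (borrow-fire S D)))
  Move-sym {D} (S , inj₂ E≐βD) = S , inj₁ (≐-sym (≐-trans (fire-cong S E≐βD) (fire-borrow S D)))

  Equiv-sym : ∀ {D E : Config b} → Equiv a b D E → Equiv a b E D
  Equiv-sym = reverse Move-sym

  LegalEquiv-sym : ∀ {D E : Config b} → LegalEquiv a b D E → LegalEquiv a b E D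
  LegalEquiv-sym = reverse λ { (D≥0 , E≥0 , D→E) → E≥0 , D≥0 , Move-sym D→E }

  LegalEquiv⇒Equiv : ∀ {D E : Config b} → LegalEquiv a b D E → Equiv a b D E
  LegalEquiv⇒Equiv ε                    = ε
  LegalEquiv⇒Equiv ((_ , _ , m) ◅ path) = m ◅ LegalEquiv⇒Equiv path

  Nonneg-≐ : ∀ {D E : Config b} → D ≐ E → Nonneg D → Nonneg E
  Nonneg-≐ D≐E D≥0 i = subst (0ℤ ≤_) (D≐E i) (D≥0 i)

  raise : ℕ → Config b → Config b
  raise m D i = D i + + m

  Nonneg-raise : ∀ {D : Config b} m → Nonneg D → Nonneg (raise m D)
  Nonneg-raise m D≥0 i = +-mono-≤ (D≥0 i) (+≤+ z≤n)

  borrow-all : ∀ (D : Config b) → borrow a b ⊤ D ≐ raise 1 D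
  borrow-all D i = trans (borrow-inside ⊤ D (lookup-replicate i true))
                         (cong (λ s → D i + + s) (trans (cong (loss a b) (∣⊤∣≡n b)) loss-full))

  ≐⇒Equiv : ∀ {D E : Config b} → D ≐ E → Equiv a b D E
  ≐⇒Equiv {D} D≐E =
    (⊤ , inj₂ (λ _ → refl)) ◅ (⊤ , inj₁ (≐-trans (≐-sym D≐E) (≐-sym (fire-borrow ⊤ D)))) ◅ ε

  ≐⇒LegalEquiv : ∀ {D E : Config b} → Nonneg D → D ≐ E → LegalEquiv a b D E
  ≐⇒LegalEquiv {D} D≥0 D≐E =
      (D≥0 , βD≥0 , ⊤ , inj₂ (λ _ → refl))
    ◅ (βD≥0 , Nonneg-≐ D≐E D≥0 , ⊤ , inj₁ (≐-trans (≐-sym D≐E) (≐-sym (fire-borrow ⊤ D))))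
    ◅ ε
    where
    βD≥0 : Nonneg (borrow a b ⊤ D)
    βD≥0 = Nonneg-≐ (≐-sym (borrow-all D)) (Nonneg-raise 1 D≥0)

  LegalEquiv-≐ʳ : ∀ {D E F : Config b} → Nonneg E → LegalEquiv a b D E → E ≐ F → LegalEquiv a b D F
  LegalEquiv-≐ʳ E≥0 D→E E≐F = D→E ◅◅ ≐⇒LegalEquiv E≥0 E≐F

  private
    raise-suc : ∀ m (D : Config b) → raise (suc m) D ≐ borrow a b ⊤ (raise m D)
    raise-suc m D i = trans (solve (D i) (+ m)) (sym (borrow-all (raise m D) i))
      where
      solve : ∀ x y → x + (+ 1 + y) ≡ x + y + + 1
      solve = solve-∀

  Equiv-raise : ∀ (D : Config b) m → Equiv a b D (raise m D)
  Equiv-raise D zero    = ≐⇒Equiv (λ i → sym (+-identityʳ (D i)))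
  Equiv-raise D (suc m) = Equiv-raise D m ◅◅ (⊤ , inj₂ (raise-suc m D)) ◅ ε

  LegalEquiv-raise : ∀ {D : Config b} m → Nonneg D → LegalEquiv a b D (raise m D)
  LegalEquiv-raise {D} zero    D≥0 = ≐⇒LegalEquiv D≥0 (λ i → sym (+-identityʳ (D i)))
  LegalEquiv-raise {D} (suc m) D≥0 =
    LegalEquiv-raise m D≥0 ◅◅ (Nonneg-raise m D≥0 , Nonneg-raise (suc m) D≥0 , ⊤ , inj₂ (raise-suc m D)) ◅ ε

module _ where
  open import Data.Integer using (+_; -[1+_]; _-_)
  open import Data.Integer.Properties using (+-identityʳ)

  ℤ-as-difference : ∀ z → Σ ℕ λ p → Σ ℕ λ m → z ≡ + p - + m
  ℤ-as-difference (+ n)    = n , 0 , sym (+-identityʳ (+ n))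
  ℤ-as-difference -[1+ n ] = 0 , ℕ.suc n , refl

module Congruence (a b : ℕ) {{_ : NonZero a}} {{_ : NonZero b}} (cop : Coprime a b) where
  import Data.Nat.Properties as ℕP
  open import Data.Integer using (ℤ; +_; 0ℤ; _+_; _-_; -_; _*_)
  open import Data.Integer.Properties using (pos-+)
  open import Data.Integer.Divisibility.Signed using (_∣_; divides; ∣m⇒∣-m; ∣m∣n⇒∣m+n)
  open import Data.Integer.Tactic.RingSolver using (solve-∀)
  open import Data.Fin.Subset.Properties using (∣p∣≤n; ∣p∣≡n⇒p≡⊤)
  open import Data.Vec.Properties using (lookup-replicate)
  open import Relation.Nullary using (yes; no)
  open GainLoss a b
  open Moves a b

  record _∼_ (D E : Config b) : Set where
    constructor congruent
    field
      offset    : ℤ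
      divisible : ∀ i → + a ∣ (E i - D i - offset)

  ∼-refl : ∀ {D} → D ∼ D
  ∼-refl {D} = congruent 0ℤ λ i → divides 0ℤ (solve (D i) (+ a))
    where
    solve : ∀ x a → x - x - 0ℤ ≡ 0ℤ * a
    solve = solve-∀

  ∼-sym : ∀ {D E} → D ∼ E → E ∼ D
  ∼-sym {D} {E} (congruent c a∣) = congruent (- c) λ i → subst (+ a ∣_) (solve (E i) (D i) c) (∣m⇒∣-m (a∣ i))
    where
    solve : ∀ x y c → - (x - y - c) ≡ y - x - - c
    solve = solve-∀

  ∼-trans : ∀ {D E F} → D ∼ E → E ∼ F → D ∼ F
  ∼-trans {D} {E} {F} (congruent c a∣) (congruent c′ a∣′) =
    congruent (c + c′) λ i → subst (+ a ∣_) (solve (D i) (E i) (F i) c c′) (∣m∣n⇒∣m+n (a∣ i) (a∣′ i))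
    where
    solve : ∀ x y z c c′ → (y - x - c) + (z - y - c′) ≡ z - x - (c + c′)
    solve = solve-∀

  ∼-respʳ-≐ : ∀ {D E F} → D ∼ E → E ≐ F → D ∼ F
  ∼-respʳ-≐ {D} (congruent c a∣) E≐F = congruent c λ i → subst (λ x → + a ∣ (x - D i - c)) (E≐F i) (a∣ i)

  ∼-⊕ : ∀ {D D′ E E′} → D ∼ D′ → E ∼ E′ → (D ⊕ E) ∼ (D′ ⊕ E′)
  ∼-⊕ {D} {D′} {E} {E′} (congruent c a∣) (congruent c′ a∣′) =
    congruent (c + c′) λ i → subst (+ a ∣_) (solve (D i) (D′ i) (E i) (E′ i) c c′) (∣m∣n⇒∣m+n (a∣ i) (a∣′ i))
    where
    solve : ∀ d d′ e e′ c c′ → (d′ - d - c) + (e′ - e - c′) ≡ (d′ + e′) - (d + e) - (c + c′)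
    solve = solve-∀

  ∼-⊖ : ∀ {D D′} → D ∼ D′ → (⊖ D) ∼ (⊖ D′)
  ∼-⊖ {D} {D′} (congruent c a∣) = congruent (- c) λ i → subst (+ a ∣_) (solve (D i) (D′ i) c) (∣m⇒∣-m (a∣ i))
    where
    solve : ∀ d d′ c → - (d′ - d - c) ≡ (- d′) - (- d) - (- c)
    solve = solve-∀

  -- For s < b firing moves S by -loss s = gain s - a and the rest by gain s;
  -- firing everything moves every vertex by -1.
  fire-∼ : ∀ S (D : Config b) → D ∼ fire a b S D
  fire-∼ S D with ∣ S ∣ ℕ.<? b
  ... | yes s<b = congruent (+ gain a b ∣ S ∣) pointwise
    where
    pointwise : ∀ i → + a ∣ (fire a b S D i - D i - + gain a b ∣ S ∣)
    pointwise i with lookup S i in i∈?S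
    ... | true  = divides (- + 1) (begin
      (D i - + l) - D i - + g ≡⟨ solve (D i) (+ l) (+ g) ⟩
      - (+ l + + g)           ≡⟨ cong -_ (sym (pos-+ l g)) ⟩
      - + (l ℕ.+ g)           ≡⟨ cong (λ x → - + x) (loss+gain≡a cop (∣p∣>0 S i∈?S) s<b) ⟩
      - + a                   ≡⟨ solve′ (+ a) ⟩
      - + 1 * + a             ∎)
      where
      open ≡-Reasoning
      l g : ℕ
      l = loss a b ∣ S ∣
      g = gain a b ∣ S ∣
      solve : ∀ x l g → (x - l) - x - g ≡ - (l + g)
      solve = solve-∀
      solve′ : ∀ x → - x ≡ - + 1 * x
      solve′ = solve-∀
    ... | false = divides 0ℤ (solve (D i) (+ gain a b ∣ S ∣) (+ a))
      where
      solve : ∀ x g a → (x + g) - x - g ≡ 0ℤ * a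
      solve = solve-∀
  ... | no s≮b = congruent (- + loss a b ∣ S ∣) λ i →
        divides 0ℤ (trans (cong (λ x → x - D i - - + loss a b ∣ S ∣) (fire-inside S D (all-inside i)))
                          (solve (D i) (+ loss a b ∣ S ∣) (+ a)))
    where
    all-inside : ∀ i → lookup S i ≡ true
    all-inside i = subst (λ T → lookup T i ≡ true)
                         (sym (∣p∣≡n⇒p≡⊤ {p = S} (ℕP.≤-antisym (∣p∣≤n S) (ℕP.≮⇒≥ s≮b))))
                         (lookup-replicate i true)
    solve : ∀ x l a → (x - l) - x - - l ≡ 0ℤ * a
    solve = solve-∀

  Move⇒∼ : ∀ {D E} → Move a b D E → D ∼ E
  Move⇒∼ {D} (S , inj₁ E≐φD) = ∼-respʳ-≐ (fire-∼ S D) (≐-sym E≐φD)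
  Move⇒∼ {D} {E} (S , inj₂ E≐βD) = ∼-sym (∼-respʳ-≐ (fire-∼ S E) (≐-trans (fire-cong S E≐βD) (fire-borrow S D)))

  Equiv⇒∼ : ∀ {D E} → Equiv a b D E → D ∼ E
  Equiv⇒∼ ε              = ∼-refl
  Equiv⇒∼ (move ◅ moves) = ∼-trans (Move⇒∼ move) (Equiv⇒∼ moves)

module Connectivity (a b : ℕ) {{_ : NonZero a}} {{_ : NonZero b}} (cop : Coprime a b) where
  import Data.Nat.Properties as ℕP
  open import Data.Integer using (ℤ; +_; -[1+_]; 0ℤ; _+_; _-_; _*_; _≤_; +≤+) renaming (∣_∣ to abs)
  open import Data.Integer.Properties using (pos-+; pos-*; +-identityʳ; +-assoc; ⊖-≥; +-mono-≤)
  open import Data.Integer.Divisibility.Signed using (_∣_)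
  open import Data.Integer.Tactic.RingSolver using (solve-∀)
  open import Data.Fin.Subset.Properties using (∣p∣≤n; ∣p∣≡n⇒p≡⊤)
  open import Data.Vec.Properties using (lookup-replicate; lookup∘tabulate)
  open import Relation.Nullary using (yes; no; does)
  open GainLoss a b
  open Moves a b
  open Congruence a b cop

  addMultiples : (Fin b → ℕ) → Config b → Config b
  addMultiples v D i = D i + + (v i ℕ.* a)

  Nonneg-addMultiples : ∀ v {D} → Nonneg D → Nonneg (addMultiples v D)
  Nonneg-addMultiples v D≥0 i = +-mono-≤ (D≥0 i) (+≤+ ℕ.z≤n)

  -- Raising every vertex by gain |T| and then borrowing T adds a exactly on T.
  LegalEquiv-add-subset : ∀ T {D} → Nonneg D → LegalEquiv a b D (addMultiples (indicator ∘ lookup T) D)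
  LegalEquiv-add-subset T {D} D≥0 with ∣ T ∣ ℕ.≟ 0 | ∣ T ∣ ℕ.<? b
  ... | yes ∣T∣≡0 | _ = ≐⇒LegalEquiv D≥0 nothing-added
    where
    nothing-added : D ≐ addMultiples (indicator ∘ lookup T) D
    nothing-added i with lookup T i in i∈?T
    ... | true  = ⊥-elim (ℕP.<⇒≢ (∣p∣>0 T i∈?T) (sym ∣T∣≡0))
    ... | false = sym (+-identityʳ (D i))
  ... | no ∣T∣≢0 | yes ∣T∣<b =
    LegalEquiv-raise g D≥0 ◅◅
    (Nonneg-raise g D≥0 , Nonneg-addMultiples (indicator ∘ lookup T) D≥0 , T , inj₂ borrowed) ◅ ε
    where
    g : ℕ
    g = gain a b ∣ T ∣
    l+g≡a : loss a b ∣ T ∣ ℕ.+ g ≡ a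
    l+g≡a = loss+gain≡a cop (ℕP.n≢0⇒n>0 ∣T∣≢0) ∣T∣<b
    borrowed : addMultiples (indicator ∘ lookup T) D ≐ borrow a b T (raise g D)
    borrowed i with lookup T i in i∈?T
    ... | true  = begin
      D i + + (1 ℕ.* a)               ≡⟨ cong (λ x → D i + + x) (ℕP.*-identityˡ a) ⟩
      D i + + a                       ≡⟨ cong (λ x → D i + + x) (trans (sym l+g≡a) (ℕP.+-comm _ g)) ⟩
      D i + + (g ℕ.+ loss a b ∣ T ∣)  ≡⟨ cong (λ x → D i + x) (pos-+ g _) ⟩
      D i + (+ g + + loss a b ∣ T ∣)  ≡⟨ sym (+-assoc (D i) (+ g) _) ⟩
      D i + + g + + loss a b ∣ T ∣    ∎
      where open ≡-Reasoning
    ... | false = trans (+-identityʳ (D i)) (solve (D i) (+ g))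
      where
      solve : ∀ x g → x ≡ x + g - g
      solve = solve-∀
  ... | no _ | no ∣T∣≮b = LegalEquiv-≐ʳ (Nonneg-raise a D≥0) (LegalEquiv-raise a D≥0) everywhere-added
    where
    everywhere-added : raise a D ≐ addMultiples (indicator ∘ lookup T) D
    everywhere-added i
      rewrite ∣p∣≡n⇒p≡⊤ {p = T} (ℕP.≤-antisym (∣p∣≤n T) (ℕP.≮⇒≥ ∣T∣≮b)) | lookup-replicate i true
      = cong (λ x → D i + + x) (sym (ℕP.*-identityˡ a))

  private
    addMultiples-+ : ∀ u v (D : Config b) → addMultiples u (addMultiples v D) ≐ addMultiples (λ i → v i ℕ.+ u i) D
    addMultiples-+ u v D i = begin
      D i + + (v i ℕ.* a) + + (u i ℕ.* a)   ≡⟨ +-assoc (D i) _ _ ⟩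
      D i + (+ (v i ℕ.* a) + + (u i ℕ.* a)) ≡⟨ cong (λ x → D i + x) (sym (pos-+ (v i ℕ.* a) _)) ⟩
      D i + + (v i ℕ.* a ℕ.+ u i ℕ.* a)     ≡⟨ cong (λ x → D i + + x) (sym (ℕP.*-distribʳ-+ a (v i) (u i))) ⟩
      D i + + ((v i ℕ.+ u i) ℕ.* a)         ∎
      where open ≡-Reasoning

  -- Peel off the support of v, one layer at a time.
  LegalEquiv-addMultiples : ∀ v {D} → Nonneg D → LegalEquiv a b D (addMultiples v D)
  LegalEquiv-addMultiples v = layers (sum v) v (term≤sum v)
    where
    layers : ∀ m v {D} → (∀ i → v i ℕ.≤ m) → Nonneg D → LegalEquiv a b D (addMultiples v D)
    layers ℕ.zero v {D} v≤0 D≥0 = ≐⇒LegalEquiv D≥0 λ i →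
      trans (sym (+-identityʳ (D i))) (cong (λ x → D i + + (x ℕ.* a)) (sym (ℕP.n≤0⇒n≡0 (v≤0 i))))
    layers (ℕ.suc m) v {D} v≤1+m D≥0 =
      layers m lower (λ i → ℕP.∸-monoˡ-≤ 1 (v≤1+m i)) D≥0 ◅◅
      LegalEquiv-≐ʳ (Nonneg-addMultiples (indicator ∘ lookup support) (Nonneg-addMultiples lower D≥0))
                    (LegalEquiv-add-subset support (Nonneg-addMultiples lower D≥0))
                    (≐-trans (addMultiples-+ (indicator ∘ lookup support) lower D)
                             (λ i → cong (λ x → D i + + (x ℕ.* a)) (layer i)))
      where
      lower : Fin b → ℕ
      lower i = v i ℕ.∸ 1
      support : Subset b
      support = tabulate (λ i → does (0 ℕ.<? v i))
      layer : ∀ i → lower i ℕ.+ indicator (lookup support i) ≡ v i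
      layer i rewrite lookup∘tabulate (λ i → does (0 ℕ.<? v i)) i with v i
      ... | ℕ.zero  = refl
      ... | ℕ.suc k = ℕP.+-comm k 1

  -- Both sides are raised and topped up by multiples of a until they meet.
  ∼⇒LegalEquiv : ∀ {D E} → Nonneg D → Nonneg E → D ∼ E → LegalEquiv a b D E
  ∼⇒LegalEquiv {D} {E} D≥0 E≥0 (congruent c a∣) =
    (LegalEquiv-raise c⁺ D≥0 ◅◅ LegalEquiv-addMultiples q⁺ (Nonneg-raise c⁺ D≥0)) ◅◅
    LegalEquiv-sym (LegalEquiv-≐ʳ (Nonneg-addMultiples q⁻ (Nonneg-raise c⁻ E≥0))
                     (LegalEquiv-raise c⁻ E≥0 ◅◅ LegalEquiv-addMultiples q⁻ (Nonneg-raise c⁻ E≥0)) meet)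
    where
    c⁺ c⁻ : ℕ
    c⁺ = proj₁ (ℤ-as-difference c)
    c⁻ = proj₁ (proj₂ (ℤ-as-difference c))
    q : Fin b → ℤ
    q i = _∣_.quotient (a∣ i)
    q⁺ q⁻ : Fin b → ℕ
    q⁺ i = proj₁ (ℤ-as-difference (q i))
    q⁻ i = proj₁ (proj₂ (ℤ-as-difference (q i)))
    meet : addMultiples q⁻ (raise c⁻ E) ≐ addMultiples q⁺ (raise c⁺ D)
    meet i = begin
      E i + + c⁻ + + (q⁻ i ℕ.* a)
        ≡⟨ cong₂ (λ x y → x + + c⁻ + y) E≡ (pos-* (q⁻ i) a) ⟩
      (D i + c + q i * + a) + + c⁻ + + q⁻ i * + a
        ≡⟨ cong₂ (λ x y → (D i + x + y * + a) + + c⁻ + + q⁻ i * + a)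
                 (proj₂ (proj₂ (ℤ-as-difference c))) (proj₂ (proj₂ (ℤ-as-difference (q i)))) ⟩
      (D i + (+ c⁺ - + c⁻) + (+ q⁺ i - + q⁻ i) * + a) + + c⁻ + + q⁻ i * + a
        ≡⟨ solve (D i) (+ c⁺) (+ c⁻) (+ q⁺ i) (+ q⁻ i) (+ a) ⟩
      D i + + c⁺ + + q⁺ i * + a
        ≡⟨ cong (λ x → D i + + c⁺ + x) (sym (pos-* (q⁺ i) a)) ⟩
      D i + + c⁺ + + (q⁺ i ℕ.* a)
        ∎
      where
      open ≡-Reasoning
      E≡ : E i ≡ D i + c + q i * + a
      E≡ = trans (sym (solve′ (E i) (D i) c)) (cong (λ x → D i + c + x) (_∣_.equality (a∣ i)))
        where
        solve′ : ∀ x y c → y + c + (x - y - c) ≡ x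
        solve′ = solve-∀
      solve : ∀ d p m x y a → (d + (p - m) + (x - y) * a) + m + y * a ≡ d + p + x * a
      solve = solve-∀

  bound : Config b → ℕ
  bound D = sum (λ i → abs (D i))

  Nonneg-raise-bound : ∀ D {M} → bound D ℕ.≤ M → Nonneg (raise M D)
  Nonneg-raise-bound D {M} D≤M i = raised≥0 (D i) (ℕP.≤-trans (term≤sum (λ i → abs (D i)) i) D≤M)
    where
    raised≥0 : ∀ x → abs x ℕ.≤ M → 0ℤ ≤ x + + M
    raised≥0 (+ n)    _   = +≤+ ℕ.z≤n
    raised≥0 -[1+ n ] n<M = subst (0ℤ ≤_) (sym (⊖-≥ n<M)) (+≤+ ℕ.z≤n)

  ∼⇒Equiv : ∀ {D E} → D ∼ E → Equiv a b D E
  ∼⇒Equiv {D} {E} (congruent c a∣) =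
    Equiv-raise D M ◅◅ LegalEquiv⇒Equiv (∼⇒LegalEquiv (Nonneg-raise-bound D (ℕP.m≤m+n _ _))
                                                      (Nonneg-raise-bound E (ℕP.m≤n+m _ _)) raised)
                    ◅◅ Equiv-sym (Equiv-raise E M)
    where
    M : ℕ
    M = bound D ℕ.+ bound E
    raised : raise M D ∼ raise M E
    raised = congruent c λ i → subst (+ a ∣_) (solve (E i) (D i) (+ M) c) (a∣ i)
      where
      solve : ∀ x y m c → x - y - c ≡ (x + m) - (y + m) - c
      solve = solve-∀

module Stability (a b : ℕ) {{_ : NonZero a}} {{_ : NonZero b}} (cop : Coprime a b) where
  open import Data.Nat using (suc; _≤_; _<_; _≤?_; _<?_; s≤s; z≤n)
  import Data.Nat.Properties as ℕP
  open import Data.Integer as ℤ using (+_; 0ℤ; +≤+) renaming (∣_∣ to abs)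
  open import Data.Integer.Properties as ℤP using (0≤i⇒+∣i∣≡i; m-n≡m⊖n; ⊖-≥; drop‿+≤+; 0≤i-j⇒j≤i)
  open import Data.Fin.Properties using (any?)
  open import Data.Fin.Subset.Properties using (∣⊤∣≡n; ∣⁅x⁆∣≡1; ∣p∣≤n; ∣p∣≡n⇒p≡⊤; x∈⁅y⁆⇒x≡y)
  open import Data.Vec.Properties using (lookup-replicate; lookup⇒[]=)
  open import Relation.Nullary using (Dec; does)
  open import Relation.Nullary.Decidable using (_×-dec_; _→-dec_)
  open Rotation a {b}
  open GainLoss a b
  open Moves a b

  ⟦_⟧ : (Fin b → ℕ) → Config b
  ⟦ y ⟧ i = + y i

  fire-legal : ∀ S y → (∀ {i} → lookup S i ≡ true → loss a b ∣ S ∣ ≤ y i) → Nonneg (fire a b S ⟦ y ⟧)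
  fire-legal S y rich i with lookup S i in i∈?S
  ... | true  = subst (0ℤ ℤ.≤_) (sym (trans (m-n≡m⊖n (y i) (loss a b ∣ S ∣)) (⊖-≥ (rich i∈?S)))) (+≤+ z≤n)
  ... | false = +≤+ z≤n

  fire-legal⁻¹ : ∀ S y → Nonneg (fire a b S ⟦ y ⟧) → ∀ {i} → lookup S i ≡ true → loss a b ∣ S ∣ ≤ y i
  fire-legal⁻¹ S y φ≥0 {i} i∈S = drop‿+≤+ (0≤i-j⇒j≤i (subst (0ℤ ℤ.≤_) (fire-inside S ⟦ y ⟧ i∈S) (φ≥0 i)))

  -- Firing a proper S (s = |S| < b) is legal iff each of its vertices holds loss s = a - gain s
  -- chips, i.e. wraps around under rotation by gain s; firing all b vertices costs one chip each.
  ProperStable : ℕ → (Fin b → ℕ) → Set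
  ProperStable k y = ∀ {s} → s < b → 0 < s → s ≤ suc k → wraps y (gain a b s) < s

  FullStable : ℕ → (Fin b → ℕ) → Set
  FullStable k y = b ≤ suc k → ∃ λ i → y i ≡ 0

  CountStable : ℕ → (Fin b → ℕ) → Set
  CountStable k y = ProperStable k y × FullStable k y

  ProperStable-cong : ∀ {k y z} → y ≗ z → ProperStable k y → ProperStable k z
  ProperStable-cong {k} {y} {z} y≗z stable {s} s<b 0<s s≤1+k =
    subst (_< s) (wraps-cong (gain a b s) y≗z) (stable s<b 0<s s≤1+k)

  CountStable-cong : ∀ {k y z} → y ≗ z → CountStable k y → CountStable k z
  CountStable-cong y≗z (proper , full) =
    ProperStable-cong y≗z proper , λ b≤1+k → let i , yi≡0 = full b≤1+k in i , trans (sym (y≗z i)) yi≡0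

  countStable? : ∀ k → Decidable (CountStable k)
  countStable? k y = proper? ×-dec ((b ≤? suc k) →-dec any? (λ i → y i ℕ.≟ 0))
    where
    proper? : Dec (ProperStable k y)
    proper? = ℕP.allUpTo? (λ s → (0 <? s) →-dec ((s ≤? suc k) →-dec (wraps y (gain a b s) <? s))) b

  CountStable⇒Stable : ∀ {k y} → CountStable k y → Stable a b k ⟦ y ⟧
  CountStable⇒Stable {k} {y} (proper , full) = (λ i → +≤+ z≤n) , not-fireable
    where
    not-fireable : ∀ S → 0 < ∣ S ∣ → ∣ S ∣ ≤ suc k → ¬ Nonneg (fire a b S ⟦ y ⟧)
    not-fireable S 0<s s≤1+k φ≥0 with ∣ S ∣ <? b
    ... | yes s<b = ℕP.<⇒≱ (proper s<b 0<s s≤1+k) all-wrap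
      where
      all-wrap : ∣ S ∣ ≤ wraps y (gain a b ∣ S ∣)
      all-wrap = subst (_≤ wraps y (gain a b ∣ S ∣)) (sym (∣p∣≡count S)) (sum-mono-≤ pointwise)
        where
        pointwise : ∀ i → indicator (lookup S i) ≤ indicator (does (a ≤? y i ℕ.+ gain a b ∣ S ∣))
        pointwise i with lookup S i in i∈?S
        ... | false = z≤n
        ... | true  = ℕP.≤-reflexive (sym (indicator-dec-yes (a ≤? _)
                        (subst (_≤ y i ℕ.+ gain a b ∣ S ∣) (loss+gain≡a cop 0<s s<b)
                               (ℕP.+-monoˡ-≤ (gain a b ∣ S ∣) (fire-legal⁻¹ S y φ≥0 i∈?S)))))
    ... | no s≮b with full (ℕP.≤-trans (ℕP.≮⇒≥ s≮b) s≤1+k)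
    ...   | i , yi≡0 = ℕP.≤⇒≯ (subst₂ _≤_ loss≡1 yi≡0 (fire-legal⁻¹ S y φ≥0 i∈S)) (s≤s z≤n)
      where
      ∣S∣≡b : ∣ S ∣ ≡ b
      ∣S∣≡b = ℕP.≤-antisym (∣p∣≤n S) (ℕP.≮⇒≥ s≮b)
      i∈S : lookup S i ≡ true
      i∈S = subst (λ T → lookup T i ≡ true) (sym (∣p∣≡n⇒p≡⊤ {p = S} ∣S∣≡b)) (lookup-replicate i true)
      loss≡1 : loss a b ∣ S ∣ ≡ 1
      loss≡1 = trans (cong (loss a b) ∣S∣≡b) loss-full

  Stable-≐ : ∀ {k} {D E : Config b} → D ≐ E → Stable a b k D → Stable a b k E
  Stable-≐ D≐E (D≥0 , stuck) =
    Nonneg-≐ D≐E D≥0 , λ S 0<s s≤1+k φE≥0 → stuck S 0<s s≤1+k (Nonneg-≐ (fire-cong S (≐-sym D≐E)) φE≥0)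

  Stable⇒CountStable : ∀ {k D} → Stable a b k D → ∃ λ y → D ≐ ⟦ y ⟧ × Bounded y × CountStable k y
  Stable⇒CountStable {k} {D} (D≥0 , stuck) = y , D≐y , bounded , proper , full
    where
    y : Fin b → ℕ
    y i = abs (D i)
    D≐y : D ≐ ⟦ y ⟧
    D≐y i = sym (0≤i⇒+∣i∣≡i (D≥0 i))
    stuck′ : ∀ S → 0 < ∣ S ∣ → ∣ S ∣ ≤ suc k → ¬ Nonneg (fire a b S ⟦ y ⟧)
    stuck′ S 0<s s≤1+k φ≥0 = stuck S 0<s s≤1+k (Nonneg-≐ (fire-cong S (≐-sym D≐y)) φ≥0)
    bounded : Bounded y
    bounded i = ℕP.≰⇒> λ a≤yi →
      stuck′ ⁅ i ⁆ (subst (0 <_) (sym (∣⁅x⁆∣≡1 i)) (s≤s z≤n))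
                   (subst (_≤ suc k) (sym (∣⁅x⁆∣≡1 i)) (s≤s z≤n))
             (fire-legal ⁅ i ⁆ y λ {j} j∈⁅i⁆ → subst (λ x → loss a b x ≤ y j) (sym (∣⁅x⁆∣≡1 i))
               (subst (λ j → loss a b 1 ≤ y j) (sym (x∈⁅y⁆⇒x≡y i (lookup⇒[]= j ⁅ i ⁆ j∈⁅i⁆)))
                      (ℕP.≤-trans loss-1≤a a≤yi)))
    proper : ProperStable k y
    proper {s} s<b 0<s s≤1+k = ℕP.≰⇒> λ s≤wraps →
      let S , ∣S∣≡s , wrapping = choose (λ i → a ≤? y i ℕ.+ gain a b s) s s≤wraps in
      stuck′ S (subst (0 <_) (sym ∣S∣≡s) 0<s) (subst (_≤ suc k) (sym ∣S∣≡s) s≤1+k)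
             (fire-legal S y λ {i} i∈S → subst (λ x → loss a b x ≤ y i) (sym ∣S∣≡s)
               (ℕP.+-cancelʳ-≤ (gain a b s) (loss a b s) (y i)
                 (subst (_≤ y i ℕ.+ gain a b s) (sym (loss+gain≡a cop 0<s s<b)) (wrapping i∈S))))
    full : FullStable k y
    full b≤1+k with any? (λ i → y i ℕ.≟ 0)
    ... | yes zero = zero
    ... | no ¬zero = ⊥-elim (stuck′ ⊤ (subst (0 <_) (sym (∣⊤∣≡n b)) (ℕP.n≢0⇒n>0 (ℕ.≢-nonZero⁻¹ b)))
                                     (subst (_≤ suc k) (sym (∣⊤∣≡n b)) b≤1+k)
                                     (fire-legal ⊤ y λ {i} _ → subst (_≤ y i) (sym loss⊤≡1)
                                       (ℕP.n≢0⇒n>0 λ yi≡0 → ¬zero (i , yi≡0))))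
      where
      loss⊤≡1 : loss a b ∣ ⊤ {b} ∣ ≡ 1
      loss⊤≡1 = trans (cong (loss a b) (∣⊤∣≡n b)) loss-full

module Minimality (a b : ℕ) {{_ : NonZero a}} {{_ : NonZero b}} (cop : Coprime a b) where
  open import Data.Nat using (zero; suc; _+_; _*_; _∸_; _≤_; _<_; _≤?_; _<?_; s≤s; z≤n)
  open import Data.Nat.Properties
  open import Data.Nat.DivMod using (_/_; _%_; m%n<n; +-distrib-/-∣ʳ; m*n/n≡m; /-monoˡ-≤)
  open import Data.Nat.Divisibility using (divides)
  open import Relation.Nullary using (yes; no)
  open Rotation a {b}
  open GainLoss a b
  open Stability a b cop

  sum≤⇒wraps≤ : ∀ {y j} → Bounded y → j ≤ a → sum y ≤ sum (rotate j y) → a * wraps y j ≤ b * j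
  sum≤⇒wraps≤ {y} {j} y<a j≤a y≤ = +-cancelˡ-≤ (sum y) _ _ (begin
    sum y + a * wraps y j              ≤⟨ +-monoˡ-≤ _ y≤ ⟩
    sum (rotate j y) + a * wraps y j   ≡⟨ sum-rotate j y<a j≤a ⟩
    sum y + b * j                      ∎)
    where open ≤-Reasoning

  sum<⇒wraps< : ∀ {y j} → Bounded y → j ≤ a → sum y < sum (rotate j y) → a * wraps y j < b * j
  sum<⇒wraps< {y} {j} y<a j≤a y< = +-cancelˡ-< (sum y) _ _ (begin-strict
    sum y + a * wraps y j              <⟨ +-monoˡ-< _ y< ⟩
    sum (rotate j y) + a * wraps y j   ≡⟨ sum-rotate j y<a j≤a ⟩
    sum y + b * j                      ∎)
    where open ≤-Reasoning

  wraps<⇒sum< : ∀ {y j} → Bounded y → j ≤ a → a * wraps y j < b * j → sum y < sum (rotate j y)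
  wraps<⇒sum< {y} {j} y<a j≤a aW<bj = +-cancelʳ-< (a * wraps y j) _ _ (begin-strict
    sum y + a * wraps y j              <⟨ +-monoʳ-< (sum y) aW<bj ⟩
    sum y + b * j                      ≡⟨ sum-rotate j y<a j≤a ⟨
    sum (rotate j y) + a * wraps y j   ∎)
    where open ≤-Reasoning

  few-wraps : ∀ {y s} → 0 < s → s < b → a * wraps y (gain a b s) ≤ b * gain a b s → wraps y (gain a b s) < s
  few-wraps {y} {s} 0<s s<b aW≤bg = *-cancelˡ-< a _ _ (begin-strict
    a * wraps y (gain a b s)   ≤⟨ aW≤bg ⟩
    b * gain a b s             ≡⟨ *-comm b _ ⟩
    gain a b s * b             <⟨ gain*b<s*a cop 0<s s<b ⟩
    s * a                      ≡⟨ *-comm s a ⟩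
    a * s                      ∎)
    where open ≤-Reasoning

  minimum⇒ProperStable : ∀ {k y} → Bounded y → (∀ {j} → j < a → sum y ≤ sum (rotate j y)) → ProperStable k y
  minimum⇒ProperStable y<a minimal s<b 0<s _ =
    few-wraps 0<s s<b (sum≤⇒wraps≤ y<a (<⇒≤ (gain<a s<b)) (minimal (gain<a s<b)))

  -- Rotating by a - 1 wraps every vertex except the empty ones.
  minimum⇒FullStable : ∀ {k y} → Bounded y → (∀ {j} → j < a → sum y ≤ sum (rotate j y)) → FullStable k y
  minimum⇒FullStable {k} {y} y<a minimal _ with a ≤? 1
  ... | yes a≤1 = i₀ , n<1⇒n≡0 (<-≤-trans (y<a i₀) a≤1)
    where i₀ = Data.Fin.fromℕ< (ℕ.>-nonZero⁻¹ b)
  ... | no a≰1 with count<n⇒∃¬ (λ i → a ≤? y i + (a ∸ 1)) (*-cancelˡ-< a _ _ aW<ab)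
    where
    a-1<a : a ∸ 1 < a
    a-1<a = ∸-monoʳ-< {o = 0} ≤-refl (ℕ.>-nonZero⁻¹ a)
    aW<ab : a * wraps y (a ∸ 1) < a * b
    aW<ab = begin-strict
      a * wraps y (a ∸ 1) ≤⟨ sum≤⇒wraps≤ y<a (<⇒≤ a-1<a) (minimal a-1<a) ⟩
      b * (a ∸ 1)         <⟨ *-monoʳ-< b a-1<a ⟩
      b * a               ≡⟨ *-comm b a ⟩
      a * b               ∎
      where open ≤-Reasoning
  ... | i , no-wrap = i , n<1⇒n≡0 (+-cancelʳ-< (a ∸ 1) (y i) 1
                            (subst (y i + (a ∸ 1) <_) (trans (sym (m∸n+n≡m (<⇒≤ (≰⇒> a≰1)))) (+-comm (a ∸ 1) 1))
                                   (≰⇒> no-wrap)))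

  minimal-rotation : ∀ y → ∃ λ m → m < a × (∀ {j} → j < a → sum (rotate m y) ≤ sum (rotate j (rotate m y)))
  minimal-rotation y with argmin (λ _ → yes tt) (λ m → sum (rotate m y)) a (0 , ℕ.>-nonZero⁻¹ a , tt)
  ... | m , m<a , _ , least = m , m<a , λ {j} j<a → begin
    sum (rotate m y)              ≤⟨ least (m%n<n (m + j) a) tt ⟩
    sum (rotate ((m + j) % a) y)  ≡⟨ sum-cong-≗ (λ i → trans (rotate-% (m + j) y i) (sym (rotate-rotate m j y i))) ⟩
    sum (rotate j (rotate m y))   ∎
    where open ≤-Reasoning

  stable-rotation : ∀ k y → ∃ λ m → m < a × CountStable k (rotate m y)
  stable-rotation k y with minimal-rotation y
  ... | m , m<a , minimal =
    m , m<a , minimum⇒ProperStable (rotate-bounded m y) minimal , minimum⇒FullStable (rotate-bounded m y) minimal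

  -- An empty vertex never wraps, so wraps y j < b ≤ k + 1 is an admissible s in ProperStable.
  stable⇒strict-minimum : ∀ {k y} → b ≤ suc k → Bounded y → CountStable k y →
                          ∀ {j} → 0 < j → j < a → sum y < sum (rotate j y)
  stable⇒strict-minimum {k} {y} b≤1+k y<a (proper , full) {j} 0<j j<a =
    wraps<⇒sum< y<a (<⇒≤ j<a) aW<bj
    where
    N : ℕ
    N = wraps y j
    N<b : N < b
    N<b with full b≤1+k
    ... | i₀ , yi₀≡0 =
      count<n (λ i → a ≤? y i + j) {i₀} (λ a≤ → <⇒≱ j<a (subst (a ≤_) (cong (_+ j) yi₀≡0) a≤))
    aW<bj : a * N < b * j
    aW<bj = bounded N refl
      where
      bounded : ∀ M → M ≡ N → a * M < b * j
      bounded zero    _   = subst (_< b * j) (trans (*-zeroʳ b) (sym (*-zeroʳ a))) (*-monoʳ-< b 0<j)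
      bounded (suc n) M≡N = begin-strict
        a * suc n                  ≡⟨ *-comm a (suc n) ⟩
        suc n * a                  <⟨ s*a<[1+gain]*b (suc n) ⟩
        suc (gain a b (suc n)) * b ≤⟨ *-monoˡ-≤ b gain<j ⟩
        j * b                      ≡⟨ *-comm j b ⟩
        b * j                      ∎
        where
        open ≤-Reasoning
        n<b : suc n < b
        n<b = subst (_< b) (sym M≡N) N<b
        gain<j : gain a b (suc n) < j
        gain<j = ≰⇒> λ j≤gain → <⇒≱ (proper n<b (s≤s z≤n) (<⇒≤ (≤-trans n<b b≤1+k)))
                                     (subst (_≤ wraps y (gain a b (suc n))) (sym M≡N) (wraps-mono y j≤gain))

  -- Splitting a rotation by gain s at δ: the first δ steps wrap fewer than s vertices,
  -- and the remaining ones are controlled by the stability of rotate δ y.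
  window : ∀ {k y δ} → Bounded y → δ < a → (∀ {j} → j ≤ δ → sum y ≤ sum (rotate j y)) →
           ProperStable k (rotate δ y) → ProperStable k y
  window {k} {y} {δ} y<a δ<a flat stable {s} s<b 0<s s≤1+k with gain a b s ≤? δ
  ... | yes G≤δ = few-wraps 0<s s<b (sum≤⇒wraps≤ y<a (≤-trans G≤δ (<⇒≤ δ<a)) (flat G≤δ))
  ... | no G≰δ = begin-strict
    wraps y G                          ≡⟨ split ⟩
    N₁ + wraps (rotate δ y) (G ∸ δ)    <⟨ +-monoʳ-< N₁ rest ⟩
    N₁ + s′                            ≡⟨ m+[n∸m]≡n (<⇒≤ N₁<s) ⟩
    s                                  ∎
    where
    open ≤-Reasoning
    G N₁ s′ : ℕ
    G = gain a b s
    N₁ = wraps y δ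
    s′ = s ∸ N₁
    δ<G : δ < G
    δ<G = ≰⇒> G≰δ
    aN₁≤bδ : a * N₁ ≤ b * δ
    aN₁≤bδ = sum≤⇒wraps≤ y<a (<⇒≤ δ<a) (flat ≤-refl)
    N₁<s : N₁ < s
    N₁<s = *-cancelˡ-< a N₁ s (begin-strict
      a * N₁ ≤⟨ aN₁≤bδ ⟩
      b * δ  <⟨ *-monoʳ-< b δ<G ⟩
      b * G  ≡⟨ *-comm b G ⟩
      G * b  <⟨ gain*b<s*a cop 0<s s<b ⟩
      s * a  ≡⟨ *-comm s a ⟩
      a * s  ∎)
    split : wraps y G ≡ N₁ + wraps (rotate δ y) (G ∸ δ)
    split = trans (cong (wraps y) (sym (m+[n∸m]≡n (<⇒≤ δ<G))))
                  (wraps-+ δ (G ∸ δ) y<a (subst (_≤ a) (sym (m+[n∸m]≡n (<⇒≤ δ<G))) (<⇒≤ (gain<a s<b))))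
    G≤gain+δ : G ≤ gain a b s′ + δ
    G≤gain+δ = begin
      G                          ≤⟨ /-monoˡ-≤ b s*a≤ ⟩
      (s′ * a + δ * b) / b       ≡⟨ +-distrib-/-∣ʳ (s′ * a) (divides δ refl) ⟩
      gain a b s′ + (δ * b) / b  ≡⟨ cong (gain a b s′ +_) (m*n/n≡m δ b) ⟩
      gain a b s′ + δ            ∎
      where
      s*a≤ : s * a ≤ s′ * a + δ * b
      s*a≤ = begin
        s * a              ≡⟨ cong (_* a) (sym (m∸n+n≡m (<⇒≤ N₁<s))) ⟩
        (s′ + N₁) * a      ≡⟨ *-distribʳ-+ a s′ N₁ ⟩
        s′ * a + N₁ * a    ≤⟨ +-monoʳ-≤ (s′ * a) (subst₂ _≤_ (*-comm a N₁) (*-comm b δ) aN₁≤bδ) ⟩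
        s′ * a + δ * b     ∎
    rest : wraps (rotate δ y) (G ∸ δ) < s′
    rest = ≤-<-trans (wraps-mono (rotate δ y) (subst (G ∸ δ ≤_) (m+n∸n≡m (gain a b s′) δ) (∸-monoˡ-≤ δ G≤gain+δ)))
                     (stable (≤-<-trans (m∸n≤m s N₁) s<b) (m<n⇒0<n∸m N₁<s) (≤-trans (m∸n≤m s N₁) s≤1+k))

  -- j₀ is the last rotation before L not above e, and w the lowest rotation after j₀.
  descent : ∀ {k e L} → Bounded e → L < a → ProperStable k (rotate L e) → sum e < sum (rotate L e) →
            ∃ λ m → m < a × ProperStable k (rotate m e) × sum e < sum (rotate m e) × sum (rotate m e) ≤ sum e + b
  descent {k} {e} {L} e<a L<a stable e<L
    with argmax (λ j → sum (rotate j e) ≤? sum e) (λ j → j) L (0 , 0<L , ≤-reflexive (sum-cong-≗ (rotate-zero e<a)))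
    where
    0<L : 0 < L
    0<L = n≢0⇒n>0 λ { refl → <-irrefl (sym (sum-cong-≗ (rotate-zero e<a))) e<L }
  ... | j₀ , j₀<L , j₀≤e , last
    with argmin (λ j → j₀ <? j) (λ j → sum (rotate j e)) (suc L) (suc j₀ , s≤s j₀<L , ≤-refl)
  ... | w , w<1+L , j₀<w , lowest = w , ≤-<-trans w≤L L<a , proper , e<w , w≤e+b
    where
    w≤L : w ≤ L
    w≤L = ≤-pred w<1+L
    e<w : sum e < sum (rotate w e)
    e<w with m≤n⇒m<n∨m≡n w≤L
    ... | inj₁ w<L  = ≰⇒> λ w≤e → <⇒≱ j₀<w (last w<L w≤e)
    ... | inj₂ refl = e<L
    w≤e+b : sum (rotate w e) ≤ sum e + b
    w≤e+b = begin
      sum (rotate w e)         ≤⟨ lowest (s≤s j₀<L) ≤-refl ⟩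
      sum (rotate (suc j₀) e)  ≤⟨ sum-rotate-suc j₀ e ⟩
      sum (rotate j₀ e) + b    ≤⟨ +-monoˡ-≤ b j₀≤e ⟩
      sum e + b                ∎
      where open ≤-Reasoning
    flat : ∀ {j} → j ≤ L ∸ w → sum (rotate w e) ≤ sum (rotate j (rotate w e))
    flat {j} j≤δ = ≤-trans (lowest (s≤s (subst (w + j ≤_) (m+[n∸m]≡n w≤L) (+-monoʳ-≤ w j≤δ)))
                                   (<-≤-trans j₀<w (m≤m+n w j)))
                           (≤-reflexive (sum-cong-≗ (λ i → sym (rotate-rotate w j e i))))
    proper : ProperStable k (rotate w e)
    proper = window (rotate-bounded w e) (≤-<-trans (m∸n≤m L w) L<a) flat
               (ProperStable-cong (λ i → sym (trans (rotate-rotate w (L ∸ w) e i)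
                                                    (cong (λ m → rotate m e i) (m+[n∸m]≡n w≤L))))
                                  stable)

module Borrowing (a b : ℕ) {{_ : NonZero a}} {{_ : NonZero b}} (cop : Coprime a b) where
  open import Data.Nat using (_+_; _*_; _∸_; _≤_; _<_; _≤?_)
  open import Data.Nat.Properties
  open import Data.Nat.DivMod using (_%_; m<n⇒m%n≡m)
  open import Data.Integer as ℤ using (+_)
  open import Data.Integer.Properties as ℤP using (pos-+; m-n≡m⊖n; ⊖-≥)
  open import Data.Integer.Tactic.RingSolver using (solve-∀)
  open import Data.Fin.Subset.Properties using (∣p∣≤n)
  open import Data.Vec.Properties using (lookup∘tabulate)
  open import Relation.Nullary using (yes; no; does)
  open import Relation.Nullary.Decidable using (dec-true; dec-false)
  open Rotation a {b}
  open GainLoss a b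
  open Moves a b
  open Stability a b cop
  open Minimality a b cop

  staying : (Fin b → ℕ) → ℕ → Subset b
  staying y m = tabulate (λ i → not (does (a ≤? y i + m)))

  wraps+∣staying∣≡b : ∀ y m → wraps y m + ∣ staying y m ∣ ≡ b
  wraps+∣staying∣≡b y m = trans (cong (λ x → wraps y m + x) (trans (∣p∣≡count (staying y m)) (sum-cong-≗ λ i →
                                  cong indicator (lookup∘tabulate (λ i → not (does (a ≤? y i + m))) i))))
                               (count+count-not (λ i → does (a ≤? y i + m)))

  staying-loss : ∀ {y m} → Bounded y → m < a → sum y < sum (rotate m y) → sum (rotate m y) ≤ sum y + b →
                 0 < ∣ staying y m ∣ × loss a b ∣ staying y m ∣ ≡ m
  staying-loss {y} {m} y<a m<a y<m m≤y+b = 0<t , loss-between {t} (subst (λ x → a * x < b * m) (sym b∸t≡N) aN<bm)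
                                                               (subst (λ x → b * m ≤ a * x + b) (sym b∸t≡N) bm≤aN+b)
    where
    t N : ℕ
    t = ∣ staying y m ∣
    N = wraps y m
    b∸t≡N : b ∸ t ≡ N
    b∸t≡N = trans (cong (_∸ t) (sym (wraps+∣staying∣≡b y m))) (m+n∸n≡m N t)
    aN<bm : a * N < b * m
    aN<bm = sum<⇒wraps< y<a (<⇒≤ m<a) y<m
    bm≤aN+b : b * m ≤ a * N + b
    bm≤aN+b = +-cancelˡ-≤ (sum y) _ _ (begin
      sum y + b * m                ≡⟨ sum-rotate m y<a (<⇒≤ m<a) ⟨
      sum (rotate m y) + a * N     ≤⟨ +-monoˡ-≤ (a * N) m≤y+b ⟩
      sum y + b + a * N            ≡⟨ +-assoc (sum y) b (a * N) ⟩
      sum y + (b + a * N)          ≡⟨ cong (λ x → sum y + x) (+-comm b (a * N)) ⟩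
      sum y + (a * N + b)          ∎)
      where open ≤-Reasoning
    0<t : 0 < t
    0<t = n≢0⇒n>0 λ t≡0 → <⇒≱ m<a (*-cancelˡ-≤ b (subst (_≤ b * m) (aN≡ba t≡0) (<⇒≤ aN<bm)))
      where
      aN≡ba : t ≡ 0 → a * N ≡ b * a
      aN≡ba t≡0 = trans (cong (a *_) N≡b) (*-comm a b)
        where
        N≡b : N ≡ b
        N≡b = trans (sym (+-identityʳ N)) (trans (cong (λ x → N + x) (sym t≡0)) (wraps+∣staying∣≡b y m))

  -- Borrowing the vertices that do not wrap performs the rotation by m.
  borrow-rotates : ∀ {y m} → Bounded y → m < a → sum y < sum (rotate m y) → sum (rotate m y) ≤ sum y + b →
                   ∃ λ T → 0 < ∣ T ∣ × borrow a b T ⟦ y ⟧ ≐ ⟦ rotate m y ⟧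
  borrow-rotates {y} {m} y<a m<a y<m m≤y+b = T , 0<t , pointwise
    where
    T : Subset b
    T = staying y m
    t : ℕ
    t = ∣ T ∣
    0<t : 0 < t
    0<t = proj₁ (staying-loss y<a m<a y<m m≤y+b)
    loss≡m : loss a b t ≡ m
    loss≡m = proj₂ (staying-loss y<a m<a y<m m≤y+b)
    pointwise : borrow a b T ⟦ y ⟧ ≐ ⟦ rotate m y ⟧
    pointwise i with a ≤? y i + m
    ... | no a≰y+m = begin
      borrow a b T ⟦ y ⟧ i     ≡⟨ borrow-inside T ⟦ y ⟧ i∈T ⟩
      + y i ℤ.+ + loss a b t   ≡⟨ cong (λ x → + y i ℤ.+ + x) loss≡m ⟩
      + y i ℤ.+ + m            ≡⟨ pos-+ (y i) m ⟨
      + (y i + m)              ≡⟨ cong +_ (m<n⇒m%n≡m (≰⇒> a≰y+m)) ⟨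
      + ((y i + m) % a)        ∎
      where
      open ≡-Reasoning
      i∈T : lookup T i ≡ true
      i∈T = trans (lookup∘tabulate _ i) (cong not (dec-false (a ≤? y i + m) a≰y+m))
    ... | yes a≤y+m = begin
      borrow a b T ⟦ y ⟧ i     ≡⟨ borrow-outside T ⟦ y ⟧ i∉T ⟩
      + y i ℤ.- + gain a b t   ≡⟨ trans (m-n≡m⊖n (y i) (gain a b t)) (⊖-≥ gain≤y) ⟩
      + (y i ∸ gain a b t)     ≡⟨ cong +_ (trans (cong (y i + m ∸_) (sym gain+m≡a))
                                                 (y+m∸[g+m]≡y∸g (y i) m (gain a b t))) ⟨
      + (y i + m ∸ a)          ≡⟨ cong +_ (%-wrap a≤y+m (+-mono-< (y<a i) m<a)) ⟨
      + ((y i + m) % a)        ∎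
      where
      open ≡-Reasoning
      i∉T : lookup T i ≡ false
      i∉T = trans (lookup∘tabulate _ i) (cong not (dec-true (a ≤? y i + m) a≤y+m))
      t<b : t < b
      t<b = subst (t <_) (trans (+-comm t (wraps y m)) (wraps+∣staying∣≡b y m))
                  (m<m+n t (count>0 (λ i → does (a ≤? y i + m)) (dec-true (a ≤? y i + m) a≤y+m)))
      gain+m≡a : gain a b t + m ≡ a
      gain+m≡a = trans (+-comm (gain a b t) m) (trans (cong (_+ gain a b t) (sym loss≡m)) (loss+gain≡a cop 0<t t<b))
      y+m∸[g+m]≡y∸g : ∀ y m g → y + m ∸ (g + m) ≡ y ∸ g
      y+m∸[g+m]≡y∸g y m g = trans (cong₂ _∸_ (+-comm y m) (+-comm g m)) ([m+n]∸[m+o]≡n∸o m y g)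
      gain≤y : gain a b t ≤ y i
      gain≤y = +-cancelʳ-≤ m _ _ (subst (_≤ y i + m) (sym gain+m≡a) a≤y+m)

  sum-borrow : ∀ {y z} T → borrow a b T ⟦ y ⟧ ≐ ⟦ z ⟧ →
               sum z + (b ∸ ∣ T ∣) * gain a b ∣ T ∣ ≡ sum y + ∣ T ∣ * loss a b ∣ T ∣
  sum-borrow {y} {z} T β≐z = begin
    sum z + (b ∸ t) * g
      ≡⟨ cong (λ x → sum z + x * g) b∸t≡count ⟩
    sum z + count (λ i → not (lookup T i)) * g
      ≡⟨ cong (λ x → sum z + x) (*-distribʳ-sum g (λ i → indicator (not (lookup T i)))) ⟩
    sum z + sum (λ i → indicator (not (lookup T i)) * g)
      ≡⟨ ∑-distrib-+ z _ ⟨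
    sum (λ i → z i + indicator (not (lookup T i)) * g)
      ≡⟨ sum-cong-≗ pointwise ⟩
    sum (λ i → y i + indicator (lookup T i) * l)
      ≡⟨ ∑-distrib-+ y _ ⟩
    sum y + sum (λ i → indicator (lookup T i) * l)
      ≡⟨ cong (λ x → sum y + x) (trans (cong (_* l) (∣p∣≡count T))
                                       (*-distribʳ-sum l (λ i → indicator (lookup T i)))) ⟨
    sum y + t * l
      ∎
    where
    open ≡-Reasoning
    t l g : ℕ
    t = ∣ T ∣
    l = loss a b t
    g = gain a b t
    b∸t≡count : b ∸ t ≡ count (λ i → not (lookup T i))
    b∸t≡count = trans (cong (_∸ t) (sym (trans (cong (_+ u) (∣p∣≡count T)) (count+count-not (lookup T)))))
                      (m+n∸m≡n t u)
      where
      u : ℕ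
      u = count (λ i → not (lookup T i))
    pointwise : ∀ i → z i + indicator (not (lookup T i)) * g ≡ y i + indicator (lookup T i) * l
    pointwise i with lookup T i in i∈?T
    ... | true  = begin
      z i + 0       ≡⟨ +-identityʳ (z i) ⟩
      z i           ≡⟨ ℤP.+-injective z≡y+l ⟩
      y i + l       ≡⟨ cong (λ x → y i + x) (*-identityˡ l) ⟨
      y i + 1 * l   ∎
      where
      z≡y+l : + z i ≡ + (y i + l)
      z≡y+l = trans (sym (β≐z i)) (trans (borrow-inside T ⟦ y ⟧ i∈?T) (sym (pos-+ (y i) l)))
    ... | false = begin
      z i + 1 * g   ≡⟨ cong (λ x → z i + x) (*-identityˡ g) ⟩
      z i + g       ≡⟨ ℤP.+-injective z+g≡y ⟩
      y i           ≡⟨ +-identityʳ (y i) ⟨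
      y i + 0       ∎
      where
      solve : ∀ x y → x ℤ.- y ℤ.+ y ≡ x
      solve = solve-∀
      z+g≡y : + (z i + g) ≡ + y i
      z+g≡y = trans (pos-+ (z i) g) (trans (cong (ℤ._+ + g) (trans (sym (β≐z i)) (borrow-outside T ⟦ y ⟧ i∈?T)))
                                            (solve (+ y i) (+ g)))

  borrow-raises-sum : ∀ {y z} T → 0 < ∣ T ∣ → borrow a b T ⟦ y ⟧ ≐ ⟦ z ⟧ → sum y < sum z
  borrow-raises-sum {y} {z} T 0<t β≐z = +-cancelʳ-< ((b ∸ ∣ T ∣) * gain a b ∣ T ∣) (sum y) (sum z) (begin-strict
    sum y + (b ∸ ∣ T ∣) * gain a b ∣ T ∣  <⟨ +-monoʳ-< (sum y) (gain-outweighed cop 0<t (∣p∣≤n T)) ⟩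
    sum y + ∣ T ∣ * loss a b ∣ T ∣        ≡⟨ sum-borrow T β≐z ⟨
    sum z + (b ∸ ∣ T ∣) * gain a b ∣ T ∣  ∎)
    where open ≤-Reasoning

module Classes (a b : ℕ) {{_ : NonZero a}} {{_ : NonZero b}} (cop : Coprime a b) where
  open import Data.Nat using (_+_; _*_; _<_)
  open import Data.Nat.Properties using (+-cancelˡ-≡; <⇒≱; <⇒≤; *-comm)
  open import Data.Nat.DivMod using (_%_; _/_; m≡m%n+[m/n]*n; [m+kn]%n≡m%n; m<n⇒m%n≡m)
  open import Data.Nat.Divisibility as Nat using (∣⇒≤)
  open import Data.Nat.Coprimality using (coprime-divisor)
  open import Data.Integer as ℤ using (ℤ; +_; -_) renaming (_+_ to _⊞_; _-_ to _⊟_; _*_ to _⊠_)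
  open import Data.Integer.Properties using (pos-+; pos-*; +-injective)
  open import Data.Integer.DivMod using (_%ℕ_; _/ℕ_; n%ℕd<d; a≡a%ℕn+[a/ℕn]*n)
  open import Data.Integer.Divisibility.Signed using (divides; _∣_)
  open import Data.Integer.Tactic.RingSolver using (solve-∀)
  open Rotation a {b}
  open Congruence a b cop
  open Stability a b cop

  rotate-∼ : ∀ m y → ⟦ y ⟧ ∼ ⟦ rotate m y ⟧
  rotate-∼ m y = congruent (+ m) λ i → divides (- + ((y i + m) / a)) (pointwise (y i))
    where
    pointwise : ∀ x → + ((x + m) % a) ⊟ + x ⊟ + m ≡ - + ((x + m) / a) ⊠ + a
    pointwise x = begin
      + r ⊟ + x ⊟ + m          ≡⟨ solve (+ r) (+ x) (+ m) ⟩
      + r ⊟ (+ x ⊞ + m)        ≡⟨ cong (λ z → + r ⊟ z) (sym (pos-+ x m)) ⟩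
      + r ⊟ + (x + m)          ≡⟨ cong (λ z → + r ⊟ + z) (m≡m%n+[m/n]*n (x + m) a) ⟩
      + r ⊟ + (r + q * a)      ≡⟨ cong (λ z → + r ⊟ z) (trans (pos-+ r (q * a)) (cong (λ z → + r ⊞ z) (pos-* q a))) ⟩
      + r ⊟ (+ r ⊞ + q ⊠ + a)  ≡⟨ solve′ (+ r) (+ q) (+ a) ⟩
      - + q ⊠ + a              ∎
      where
      open ≡-Reasoning
      r q : ℕ
      r = (x + m) % a
      q = (x + m) / a
      solve : ∀ x y m → x ⊟ y ⊟ m ≡ x ⊟ (y ⊞ m)
      solve = solve-∀
      solve′ : ∀ r q a → r ⊟ (r ⊞ q ⊠ a) ≡ - q ⊠ a
      solve′ = solve-∀

  private
    %-congruent : ∀ x z K → + z ⊟ + x ≡ K ⊠ + a → x % a ≡ z % a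
    %-congruent x z K z-x≡Ka =
      trans (sym ([m+kn]%n≡m%n x K⁺ a)) (trans (cong (_% a) (+-injective lifted)) ([m+kn]%n≡m%n z K⁻ a))
      where
      K⁺ K⁻ : ℕ
      K⁺ = proj₁ (ℤ-as-difference K)
      K⁻ = proj₁ (proj₂ (ℤ-as-difference K))
      lifted : + (x + K⁺ * a) ≡ + (z + K⁻ * a)
      lifted = begin
        + (x + K⁺ * a)                          ≡⟨ trans (pos-+ x (K⁺ * a)) (cong (λ w → + x ⊞ w) (pos-* K⁺ a)) ⟩
        + x ⊞ + K⁺ ⊠ + a                        ≡⟨ solve (+ x) (+ z) (+ K⁺) (+ a) ⟩
        + z ⊟ (+ z ⊟ + x) ⊞ + K⁺ ⊠ + a
          ≡⟨ cong (λ w → + z ⊟ w ⊞ + K⁺ ⊠ + a) (trans z-x≡Ka (cong (_⊠ + a) (proj₂ (proj₂ (ℤ-as-difference K))))) ⟩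
        + z ⊟ (+ K⁺ ⊟ + K⁻) ⊠ + a ⊞ + K⁺ ⊠ + a  ≡⟨ solve′ (+ z) (+ K⁺) (+ K⁻) (+ a) ⟩
        + z ⊞ + K⁻ ⊠ + a                        ≡⟨ sym (trans (pos-+ z (K⁻ * a)) (cong (λ w → + z ⊞ w) (pos-* K⁻ a))) ⟩
        + (z + K⁻ * a)                          ∎
        where
        open ≡-Reasoning
        solve : ∀ x z p a → x ⊞ p ⊠ a ≡ z ⊟ (z ⊟ x) ⊞ p ⊠ a
        solve = solve-∀
        solve′ : ∀ z p m a → z ⊟ (p ⊟ m) ⊠ a ⊞ p ⊠ a ≡ z ⊞ m ⊠ a
        solve′ = solve-∀

  ∼-rotation : ∀ {y z} → Bounded z → ⟦ y ⟧ ∼ ⟦ z ⟧ → ∃ λ L → L < a × z ≗ rotate L y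
  ∼-rotation {y} {z} z<a (congruent c a∣) =
    L , n%ℕd<d c a , λ i → sym (trans (%-congruent (y i + L) (z i) (q i ⊞ c /ℕ a) (offset-by-L i)) (m<n⇒m%n≡m (z<a i)))
    where
    L : ℕ
    L = c %ℕ a
    q : Fin b → ℤ
    q i = _∣_.quotient (a∣ i)
    offset-by-L : ∀ i → + z i ⊟ + (y i + L) ≡ (q i ⊞ c /ℕ a) ⊠ + a
    offset-by-L i = begin
      + z i ⊟ + (y i + L)                       ≡⟨ cong (λ w → + z i ⊟ w) (pos-+ (y i) L) ⟩
      + z i ⊟ (+ y i ⊞ + L)                     ≡⟨ solve (+ z i) (+ y i) c (+ L) ⟩
      (+ z i ⊟ + y i ⊟ c) ⊞ (c ⊟ + L)           ≡⟨ cong₂ _⊞_ (_∣_.equality (a∣ i)) (cong (_⊟ + L) (a≡a%ℕn+[a/ℕn]*n c a)) ⟩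
      q i ⊠ + a ⊞ (+ L ⊞ (c /ℕ a) ⊠ + a ⊟ + L)  ≡⟨ solve′ (q i) (c /ℕ a) (+ L) (+ a) ⟩
      (q i ⊞ c /ℕ a) ⊠ + a                      ∎
      where
      open ≡-Reasoning
      solve : ∀ z y c L → z ⊟ (y ⊞ L) ≡ (z ⊟ y ⊟ c) ⊞ (c ⊟ L)
      solve = solve-∀
      solve′ : ∀ q d L a → q ⊠ a ⊞ (L ⊞ d ⊠ a ⊟ L) ≡ (q ⊞ d) ⊠ a
      solve′ = solve-∀

  -- Equal sums would force a ∣ b L.
  rotation-sum-injective : ∀ {y L} → Bounded y → 0 < L → L < a → sum (rotate L y) ≢ sum y
  rotation-sum-injective {y} {L} y<a 0<L L<a same-sum = <⇒≱ L<a
    (∣⇒≤ {{ℕ.>-nonZero 0<L}} (coprime-divisor cop (Nat.divides (wraps y L) (trans (sym aW≡bL) (*-comm a (wraps y L))))))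
    where
    aW≡bL : a * wraps y L ≡ b * L
    aW≡bL = +-cancelˡ-≡ (sum y) _ _ (trans (cong (_+ a * wraps y L) (sym same-sum)) (sum-rotate L y<a (<⇒≤ L<a)))

module Peaks (a b : ℕ) {{_ : NonZero a}} {{_ : NonZero b}} (cop : Coprime a b) where
  open import Data.Nat using (suc; _+_; _≤_; _<_; _≤?_)
  open import Data.Nat.Properties
  open import Data.Nat.DivMod using (_%_; m%n<n)
  open import Data.Integer as ℤ using (+_; 0ℤ; _-_; -_; _*_)
  open import Data.Integer.DivMod using (_%ℕ_; _/ℕ_; a≡a%ℕn+[a/ℕn]*n)
  open import Data.Integer.Divisibility.Signed using (divides)
  open import Data.Integer.Tactic.RingSolver using (solve-∀)
  open import Data.Empty using (⊥; ⊥-elim)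
  open Rotation a {b}
  open Moves a b
  open Congruence a b cop
  open Connectivity a b cop
  open Stability a b cop
  open Minimality a b cop
  open Borrowing a b cop
  open Classes a b cop

  Peak : ℕ → (Fin b → ℕ) → Set
  Peak k y = CountStable k y × (∀ {L} → L < a → CountStable k (rotate L y) → sum (rotate L y) ≤ sum y)

  peak-rotation : ∀ k y → ∃ λ m → Peak k (rotate m y)
  peak-rotation k y with stable-rotation k y
  ... | m₀ , m₀<a , stable₀
    with argmax (λ m → countStable? k (rotate m y)) (λ m → sum (rotate m y)) a (m₀ , m₀<a , stable₀)
  ... | m , _ , stable , highest = m , stable , λ {L} _ stable-L →
    ≤-trans (≤-reflexive (sum-cong-≗ (λ i → sym (shift L i))))
            (highest (m%n<n (m + L) a) (CountStable-cong (λ i → sym (shift L i)) stable-L))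
    where
    shift : ∀ L → rotate ((m + L) % a) y ≗ rotate L (rotate m y)
    shift L i = trans (rotate-% (m + L) y i) (sym (rotate-rotate m L y i))

  Peak⇒Skeletal : ∀ {k y} → Bounded y → Peak k y → Skeletal a b k ⟦ y ⟧
  Peak⇒Skeletal {k} {y} y<a (stable , highest) = CountStable⇒Stable stable , no-stable-borrow
    where
    no-stable-borrow : ∀ T → 0 < ∣ T ∣ → Nonneg (borrow a b T ⟦ y ⟧) → ¬ Stable a b k (borrow a b T ⟦ y ⟧)
    no-stable-borrow T 0<t _ β-stable =
      let z , β≐z , z<a , z-stable = Stable⇒CountStable β-stable
          L , L<a , z≗ = ∼-rotation z<a (∼-respʳ-≐ (Move⇒∼ (T , inj₂ (λ _ → refl))) β≐z)
      in <⇒≱ (borrow-raises-sum T 0<t β≐z)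
             (subst (_≤ sum y) (sum-cong-≗ (λ i → sym (z≗ i))) (highest L<a (CountStable-cong z≗ z-stable)))

  -- A stable rotation with a larger sum is either impossible (b ≤ k + 1) or reachable by a legal borrow.
  Skeletal⇒Peak : ∀ {k y} → Bounded y → Skeletal a b k ⟦ y ⟧ → CountStable k y → Peak k y
  Skeletal⇒Peak {k} {y} y<a (_ , no-stable-borrow) stable = stable , λ L<a stable-L → ≮⇒≥ (climb L<a stable-L)
    where
    climb : ∀ {L} → L < a → CountStable k (rotate L y) → sum y < sum (rotate L y) → ⊥
    climb {L} L<a stable-L y<L with b ≤? suc k
    ... | yes b≤1+k = <-asym y<L (subst (sum (rotate L y) <_) (sum-cong-≗ (rotate-inverse L y<a (<⇒≤ L<a)))
                        (stable⇒strict-minimum b≤1+k (rotate-bounded L y) stable-L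
                                               (m<n⇒0<n∸m L<a) (∸-monoʳ-< 0<L (<⇒≤ L<a))))
      where
      0<L : 0 < L
      0<L = n≢0⇒n>0 λ { refl → <-irrefl (sym (sum-cong-≗ (rotate-zero y<a))) y<L }
    ... | no b≰1+k =
      let m , m<a , proper , y<m , m≤y+b = descent y<a L<a (proj₁ stable-L) y<L
          T , 0<t , β≐m = borrow-rotates y<a m<a y<m m≤y+b
          β-stable = Stable-≐ (≐-sym β≐m) (CountStable⇒Stable (proper , λ b≤1+k → ⊥-elim (b≰1+k b≤1+k)))
      in no-stable-borrow T 0<t (proj₁ β-stable) β-stable

  peak-unique : ∀ {k y z} → Bounded y → Bounded z → Peak k y → Peak k z → ⟦ y ⟧ ∼ ⟦ z ⟧ → y ≗ z
  peak-unique {k} {y} {z} y<a z<a (y-stable , y-highest) (z-stable , z-highest) y∼z =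
    from-rotations (∼-rotation z<a y∼z) (∼-rotation y<a (∼-sym y∼z))
    where
    from-rotations : (∃ λ L → L < a × z ≗ rotate L y) → (∃ λ L′ → L′ < a × y ≗ rotate L′ z) → y ≗ z
    from-rotations (L , L<a , z≗) (L′ , L′<a , y≗) i =
      sym (trans (z≗ i) (trans (cong (λ l → rotate l y i) L≡0) (rotate-zero y<a i)))
      where
      same-sum : sum (rotate L y) ≡ sum y
      same-sum = ≤-antisym (y-highest L<a (CountStable-cong z≗ z-stable)) (begin
        sum y               ≡⟨ sum-cong-≗ y≗ ⟩
        sum (rotate L′ z)   ≤⟨ z-highest L′<a (CountStable-cong y≗ y-stable) ⟩
        sum z               ≡⟨ sum-cong-≗ z≗ ⟩
        sum (rotate L y)    ∎)
        where open ≤-Reasoning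
      L≡0 : L ≡ 0
      L≡0 with L ℕ.≟ 0
      ... | yes L≡0 = L≡0
      ... | no L≢0  = ⊥-elim (rotation-sum-injective y<a (n≢0⇒n>0 L≢0) L<a same-sum)

  Skeletal-≐ : ∀ {k} {D E : Config b} → D ≐ E → Skeletal a b k D → Skeletal a b k E
  Skeletal-≐ D≐E (stable , no-stable-borrow) = Stable-≐ D≐E stable , λ T 0<t βE≥0 βE-stable →
    no-stable-borrow T 0<t (Nonneg-≐ (borrow-cong T (≐-sym D≐E)) βE≥0) (Stable-≐ (borrow-cong T (≐-sym D≐E)) βE-stable)

  skeletal-exists : ∀ k D → ∃ λ E → Skeletal a b k E × Equiv a b D E
  skeletal-exists k D =
    let m , peak = peak-rotation k y
    in ⟦ rotate m y ⟧ , Peak⇒Skeletal (rotate-bounded m y) peak , ∼⇒Equiv (∼-trans D∼y (rotate-∼ m y))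
    where
    y : Fin b → ℕ
    y i = D i %ℕ a
    D∼y : D ∼ ⟦ y ⟧
    D∼y = congruent 0ℤ λ i → divides (- (D i /ℕ a)) (trans (cong (λ x → ⟦ y ⟧ i - x - 0ℤ) (a≡a%ℕn+[a/ℕn]*n (D i) a))
                                                              (solve (⟦ y ⟧ i) (D i /ℕ a) (+ a)))
      where
      solve : ∀ r q a → r - (r ℤ.+ q * a) - 0ℤ ≡ - q * a
      solve = solve-∀

  skeletal-unique : ∀ {k D E E′} → Skeletal a b k E → Skeletal a b k E′ → Equiv a b D E → Equiv a b D E′ → E ≐ E′
  skeletal-unique {k} {D} {E} {E′} E-skeletal E′-skeletal D≈E D≈E′ i =
    let y , E≐y , y<a , y-stable = Stable⇒CountStable (proj₁ E-skeletal)
        z , E′≐z , z<a , z-stable = Stable⇒CountStable (proj₁ E′-skeletal)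
        y∼z = ∼-sym (∼-respʳ-≐ (∼-sym (∼-respʳ-≐ (Equiv⇒∼ (Equiv-sym D≈E ◅◅ D≈E′)) E′≐z)) E≐y)
        y≗z = peak-unique y<a z<a (peak y<a E≐y y-stable E-skeletal) (peak z<a E′≐z z-stable E′-skeletal) y∼z
    in trans (E≐y i) (trans (cong +_ (y≗z i)) (sym (E′≐z i)))
    where
    peak : ∀ {F x} → Bounded x → F ≐ ⟦ x ⟧ → CountStable k x → Skeletal a b k F → Peak k x
    peak x<a F≐x x-stable F-skeletal = Skeletal⇒Peak x<a (Skeletal-≐ F≐x F-skeletal) x-stable

open import Data.Nat using (_∸_)
open import Data.Fin using (zero; suc)
open import Data.Integer as ℤ using (ℤ; +_)
open import Data.Integer.Divisibility using (_∣_)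

module Differences (a n : ℕ) {{_ : NonZero a}} (cop : Coprime a (ℕ.suc n)) where
  open import Data.Integer using (0ℤ; _+_; _-_; -_; _*_)
  open import Data.Integer.Divisibility.Signed as Signed using (divides; ∣m⇒∣-m; ∣m∣n⇒∣m-n; ∣ᵤ⇒∣; ∣⇒∣ᵤ)
  open import Data.Integer.Tactic.RingSolver using (solve-∀)
  open Congruence a (ℕ.suc n) cop

  differences : Config (ℕ.suc n) → Fin n → ℤ
  differences D j = D (suc j) - D zero

  differences-⊕ : ∀ D E j → differences (D ⊕ E) j ≡ differences D j + differences E j
  differences-⊕ D E j = solve (D (suc j)) (E (suc j)) (D zero) (E zero)
    where
    solve : ∀ x y u v → (x + y) - (u + v) ≡ (x - u) + (y - v)
    solve = solve-∀

  differences-surjective : ∀ (v : Fin n → ℤ) → Σ (Config (ℕ.suc n)) λ D → ∀ j → differences D j ≡ v j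
  differences-surjective v = D , λ j → solve (v j)
    where
    D : Config (ℕ.suc n)
    D zero    = 0ℤ
    D (suc j) = v j
    solve : ∀ x → x - 0ℤ ≡ x
    solve = solve-∀

  ∼⇒differences-≡ : ∀ {D D′} → D ∼ D′ → ∀ j → + a ∣ (differences D j - differences D′ j)
  ∼⇒differences-≡ {D} {D′} (congruent c a∣) j = ∣⇒∣ᵤ
    (subst (+ a Signed.∣_) (solve (D zero) (D′ zero) (D (suc j)) (D′ (suc j)) c) (∣m∣n⇒∣m-n (a∣ zero) (a∣ (suc j))))
    where
    solve : ∀ d₀ d₀′ d₁ d₁′ c → (d₀′ - d₀ - c) - (d₁′ - d₁ - c) ≡ (d₁ - d₀) - (d₁′ - d₀′)
    solve = solve-∀

  differences-≡⇒∼ : ∀ {D D′} → (∀ j → + a ∣ (differences D j - differences D′ j)) → D ∼ D′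
  differences-≡⇒∼ {D} {D′} a∣ = congruent (D′ zero - D zero) pointwise
    where
    solve : ∀ d d′ a → d′ - d - (d′ - d) ≡ 0ℤ * a
    solve = solve-∀
    solve′ : ∀ d₀ d₀′ d₁ d₁′ → - ((d₁ - d₀) - (d₁′ - d₀′)) ≡ d₁′ - d₁ - (d₀′ - d₀)
    solve′ = solve-∀
    pointwise : ∀ i → + a Signed.∣ (D′ i - D i - (D′ zero - D zero))
    pointwise zero    = divides 0ℤ (solve (D zero) (D′ zero) (+ a))
    pointwise (suc j) =
      subst (+ a Signed.∣_) (solve′ (D zero) (D′ zero) (D (suc j)) (D′ (suc j))) (∣m⇒∣-m (∣ᵤ⇒∣ (a∣ j)))

theorem1p9 : (a b : ℕ) → {{_ : NonZero a}} → {{_ : NonZero b}} → Coprime a b →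
    -- (a) addition and negation respect ≈ (so the quotient is a group), and
    --     there is a surjective homomorphism ℤ^b → ℤ^(b-1) whose composite with
    --     reduction mod a has kernel exactly ≈, i.e. ℤ^b/≈ ≅ (ℤ/aℤ)^(b-1)
    ((∀ (D D' E E' : Config b) → Equiv a b D D' → Equiv a b E E' →
        Equiv a b (D ⊕ E) (D' ⊕ E'))
     × (∀ (D D' : Config b) → Equiv a b D D' → Equiv a b (⊖ D) (⊖ D'))
     × Σ (Config b → (Fin (b ∸ 1) → ℤ)) (λ f →
         (∀ (D E : Config b) (j : Fin (b ∸ 1)) → f (D ⊕ E) j ≡ f D j ℤ.+ f E j)
         × (∀ (v : Fin (b ∸ 1) → ℤ) → Σ (Config b) λ D → ∀ j → f D j ≡ v j)
         × (∀ (D D' : Config b) → Equiv a b D D' → ∀ j → (+ a) ∣ (f D j ℤ.- f D' j))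
         × (∀ (D D' : Config b) → (∀ j → (+ a) ∣ (f D j ℤ.- f D' j)) → Equiv a b D D')))
    -- (b) every class contains a nonnegative configuration
    × (∀ (D : Config b) → Σ (Config b) λ E → Nonneg E × Equiv a b D E)
    -- (c) equivalent nonnegative configurations are connected by legal moves
    × (∀ (D D' : Config b) → Nonneg D → Nonneg D' → Equiv a b D D' → LegalEquiv a b D D')
    -- (d) each class contains exactly one k-skeletal configuration, 0 ≤ k < b
    × (∀ (k : ℕ) → k ℕ.< b → ∀ (D : Config b) →
         (Σ (Config b) λ E → Skeletal a b k E × Equiv a b D E)
         × (∀ (E E' : Config b) → Skeletal a b k E → Skeletal a b k E' →
              Equiv a b D E → Equiv a b D E' → E ≐ E'))
theorem1p9 a b@(ℕ.suc n) cop =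
  ( (λ _ _ _ _ D≈D′ E≈E′ → ∼⇒Equiv (∼-⊕ (Equiv⇒∼ D≈D′) (Equiv⇒∼ E≈E′)))
  , (λ _ _ D≈D′ → ∼⇒Equiv (∼-⊖ (Equiv⇒∼ D≈D′)))
  , differences , differences-⊕ , differences-surjective
  , (λ _ _ D≈D′ → ∼⇒differences-≡ (Equiv⇒∼ D≈D′))
  , (λ _ _ a∣ → ∼⇒Equiv (differences-≡⇒∼ a∣)) )
  , (λ D → raise (bound D) D , Nonneg-raise-bound D ℕP.≤-refl , Equiv-raise D (bound D))
  , (λ _ _ D≥0 D′≥0 D≈D′ → ∼⇒LegalEquiv D≥0 D′≥0 (Equiv⇒∼ D≈D′))
  , λ k _ D → skeletal-exists k D , λ _ _ E-skeletal E′-skeletal → skeletal-unique E-skeletal E′-skeletal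
  where
  import Data.Nat.Properties as ℕP
  open Moves a b
  open Congruence a b cop
  open Connectivity a b cop
  open Differences a n cop
  open Peaks a b cop
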